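{- Let $n\ge2$ be even, $\ell_1,\dots,\ell_n$ distinct primes with $\ell_1\equiv 3\pmod 8$, $\ell_i\equiv 5\pmod 8$ ($i\ge2$), $\big(\frac{\ell_1}{\ell_2}\big)=-1$, $\big(\frac{\ell_1}{\ell_j}\big)=1$ ($j\ge3$), $\big(\frac{\ell_i}{\ell_j}\big)=-1$ ($2\le i<j\le n$); let $m=\ell_1\cdots\ell_n$, $K=\mathbb{Q}(\sqrt m)$, and write the fundamental unit of $K$ as $\varepsilon=a+b\sqrt m$ with $a,b\in\mathbb{Z}$. Then $b$ is odd.
   Context: $\big(\frac{\cdot}{\cdot}\big)$ is the Legendre symbol. Since $m\equiv -1\pmod 8$, the ring of integers of $K$ is $\mathbb{Z}[\sqrt m]$. -}

module Defs where

open import Data.Nat as ℕ using (ℕ; zero; suc; _%_)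
open import Data.Nat.Divisibility using (_∣_; _∣?_)
open import Data.Integer as ℤ using (ℤ; +_; -_; _<_; _≤_)
open import Data.List using (List; map; allFin; upTo)
open import Data.Nat.ListAction using (product)
open import Data.List.Relation.Unary.Any using (any?)
open import Data.Fin using (Fin)
open import Data.Product using (∃; _×_)
open import Data.Sum using (_⊎_)
open import Relation.Binary.PropositionalEquality using (_≡_)
open import Relation.Nullary using (yes; no)
open import Data.Nat.Properties using (_≟_)

legendre : ℕ → (p : ℕ) → .{{_ : ℕ.NonZero p}} → ℤ
legendre a p with p ∣? a
... | yes _ = + 0
... | no _ with any? (λ x → (x ℕ.* x) % p ≟ a % p) (upTo p)
...   | yes _ = + 1
...   | no _ = - (+ 1)

prodFin : (n : ℕ) → (Fin n → ℕ) → ℕ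
prodFin n f = product (map f (allFin n))

IsUnit : ℕ → ℤ → ℤ → Set
IsUnit m a b = (a ℤ.* a ℤ.- (+ m) ℤ.* b ℤ.* b ≡ + 1) ⊎ (a ℤ.* a ℤ.- (+ m) ℤ.* b ℤ.* b ≡ - (+ 1))

-- a + b √m is the fundamental unit of ℤ[√m] (m > 1 squarefree): the
-- smallest unit > 1. For a unit, a + b√m > 1 iff a > 0 and b > 0, and
-- among such units the order of a + b√m agrees with the order of b
-- (and of a).
IsFundamentalUnit : ℕ → ℤ → ℤ → Set
IsFundamentalUnit m a b =
  IsUnit m a b × (+ 0 < a) × (+ 0 < b) ×
  (∀ a' b' → IsUnit m a' b' → + 0 < a' → + 0 < b' → (a ≤ a') × (b ≤ b'))

{-# OPTIONS --safe #-}
-- Write m = ℓ₁⋯ℓₙ and suppose b = 2c. Reducing a² − m b² = ±1 modulo 4 leaves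
-- a = 2k + 1 with k (k + 1) = m c². As k and k + 1 are coprime and m is squarefree,
-- k + 1 = e g² and k = d t², where e is the product of the ℓᵢ dividing k + 1 and
-- e d = m. Reading e g² − d t² = 1 modulo each ℓⱼ says that e is a square mod ℓⱼ
-- when ℓⱼ ∣ d, and that −d is one when ℓⱼ ∣ e. By Euler's criterion and quadratic
-- reciprocity (which makes the prescribed symbols symmetric, as ℓᵢ ≡ 1 mod 4 for
-- i ≥ 2) this is a linear system over 𝔽₂ for the indicator vector of e, and its
-- only solution is 0. Hence e = 1, and g + t√m is a unit with 0 < t < b,
-- contradicting the minimality of ε. Quadratic reciprocity follows from Gauss's
-- lemma by Eisenstein's lattice-point count, and Euler's criterion by counting the
-- roots of x^h − 1 modulo p.
module Submission where

open import Defs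
open import Data.Nat using (ℕ; _*_; _%_; _≤_; _<_; NonZero)
open import Data.Nat.Primality using (Prime)
open import Data.Integer using (ℤ; +_; -_; ∣_∣)
open import Data.Fin using (Fin; toℕ)
open import Data.Product using (∃)
open import Function.Definitions using (Injective)
open import Relation.Binary.PropositionalEquality using (_≡_)

open import Data.Nat as ℕ using (zero; suc; parity; _∸_; _≤ᵇ_; _⊓_; _<?_; z≤n; s≤s)
import Data.Nat.Properties as ℕ
open import Data.Nat.Divisibility as ℕ∣ using (_∣_; divides; _∣?_)
open import Data.Nat.DivMod using (_/_; m≡m%n+[m/n]*n; m%n<n; [m+kn]%n≡m%n; m<n⇒m%n≡m; m*n/n≡m; m/n*n≤m; /-monoˡ-≤; m<n*o⇒m/o<n)
open import Data.Nat.Primality using (prime⇒nonZero; prime⇒nonTrivial; prime⇒irreducible; euclidsLemma)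
open import Data.Nat.GCD using (gcd; gcd[m,n]∣m; gcd[m,n]∣n; gcd[m,n]≡0⇒m≡0)
open import Data.Nat.Coprimality as Coprime using (Coprime; coprime-divisor; coprime-/gcd)
open import Data.Nat.ListAction using (product)
import Data.Nat.Tactic.RingSolver as ℕ-Solver
open import Data.Integer as ℤ using (_+_; _-_; _^_; +<+; +[1+_]; -[1+_])
import Data.Integer.Properties as ℤ
import Data.Integer.Divisibility.Signed as ℤ∣
open import Data.Integer.Tactic.RingSolver using (solve-∀)
open import Data.Parity as ℙ using (Parity; 0ℙ; 1ℙ)
import Data.Parity.Properties as ℙ
open import Data.Bool using (true; false; if_then_else_)
open import Data.Fin as Fin using (zero; suc; fromℕ<; punchOut)
import Data.Fin.Properties as Fin
open import Data.Fin.Permutation using (Permutation; permutation)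
open import Data.Vec using (Vec; []; _∷_; replicate)
open import Data.Vec.Functional as Vector using (Vector)
open import Data.List using (map; allFin; tabulate; upTo)
open import Data.List.Properties using (map-tabulate)
open import Data.List.Relation.Unary.Any using (any?)
open import Data.List.Membership.Propositional using (find; lose)
open import Data.List.Membership.Propositional.Properties using (∈-upTo⁺)
open import Algebra.Bundles using (CommutativeMonoid)
import Algebra.Properties.CommutativeMonoid.Sum as Sum
open import Data.Product using (∃₂; _×_; _,_; proj₁; proj₂)
open import Data.Sum using (_⊎_; inj₁; inj₂)
open import Function using (_∘_; id)
open import Relation.Binary.Bundles using (Setoid)
open import Relation.Binary.Structures using (IsEquivalence)
open import Relation.Binary.Definitions using (tri<; tri≈; tri>)
open import Relation.Binary.PropositionalEquality using (_≢_; refl; sym; trans; cong; cong₂; subst; subst₂; module ≡-Reasoning)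
import Relation.Binary.Reasoning.Setoid
open import Relation.Nullary using (¬_; yes; no)
open import Relation.Nullary.Negation using (contradiction)
open import Relation.Nullary.Reflects using (ofʸ; ofⁿ)

open Sum ℤ.*-1-commutativeMonoid using () renaming (sum to ∏; ∑-distrib-+ to ∏-distrib-*; sum-cong-≗ to ∏-cong)
open Sum ℕ.*-1-commutativeMonoid using () renaming (sum to ∏ℕ; ∑-distrib-+ to ∏ℕ-distrib-*; sum-cong-≗ to ∏ℕ-cong; sum-replicate-zero to ∏ℕ-ones)
open Sum ℕ.+-0-commutativeMonoid using () renaming (sum to ∑ℕ; ∑-distrib-+ to ∑ℕ-distrib-+; ∑-comm to ∑ℕ-comm; sum-cong-≗ to ∑ℕ-cong)
open Sum ℙ.+-0-commutativeMonoid using () renaming (sum to ∑ℙ; ∑-distrib-+ to ∑ℙ-distrib-+; sum-cong-≗ to ∑ℙ-cong)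

-- Congruences of integers

infix 4 _≡_mod_

-- A record rather than a synonym for + n ∣ x - y, so that x and y stay inferable.
record _≡_mod_ (x y : ℤ) (n : ℕ) : Set where
  constructor mod∣
  field ∣-difference : + n ℤ∣.∣ x - y

module _ {n : ℕ} where

  ≡⇒≡-mod : ∀ {x y} → x ≡ y → x ≡ y mod n
  ≡⇒≡-mod {x} refl = mod∣ (ℤ∣.divides (+ 0) (ℤ.+-inverseʳ x))

  ≡-mod-refl : ∀ {x} → x ≡ x mod n
  ≡-mod-refl = ≡⇒≡-mod refl

  ≡-mod-sym : ∀ {x y} → x ≡ y mod n → y ≡ x mod n
  ≡-mod-sym {x} {y} (mod∣ d) = mod∣ (subst (+ n ℤ∣.∣_) (swap x y) (ℤ∣.∣m⇒∣-m d))
    where swap : ∀ x y → - (x - y) ≡ y - x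
          swap = solve-∀

  ≡-mod-trans : ∀ {x y z} → x ≡ y mod n → y ≡ z mod n → x ≡ z mod n
  ≡-mod-trans {x} {y} {z} (mod∣ d) (mod∣ e) = mod∣ (subst (+ n ℤ∣.∣_) (telescope x y z) (ℤ∣.∣m∣n⇒∣m+n d e))
    where telescope : ∀ x y z → (x - y) + (y - z) ≡ x - z
          telescope = solve-∀

  ≡-mod-isEquivalence : IsEquivalence (_≡_mod n)
  ≡-mod-isEquivalence = record { refl = ≡-mod-refl ; sym = ≡-mod-sym ; trans = ≡-mod-trans }

  +-cong-mod : ∀ {x x′ y y′} → x ≡ x′ mod n → y ≡ y′ mod n → x + y ≡ x′ + y′ mod n
  +-cong-mod {x} {x′} {y} {y′} (mod∣ d) (mod∣ e) = mod∣ (subst (+ n ℤ∣.∣_) (regroup x x′ y y′) (ℤ∣.∣m∣n⇒∣m+n d e))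
    where regroup : ∀ x x′ y y′ → (x - x′) + (y - y′) ≡ (x + y) - (x′ + y′)
          regroup = solve-∀

  *-cong-mod : ∀ {x x′ y y′} → x ≡ x′ mod n → y ≡ y′ mod n → x ℤ.* y ≡ x′ ℤ.* y′ mod n
  *-cong-mod {x} {x′} {y} {y′} (mod∣ d) (mod∣ e) =
    mod∣ (subst (+ n ℤ∣.∣_) (regroup x x′ y y′) (ℤ∣.∣m∣n⇒∣m+n (ℤ∣.∣m⇒∣m*n y d) (ℤ∣.∣n⇒∣m*n x′ e)))
    where regroup : ∀ x x′ y y′ → (x - x′) ℤ.* y + x′ ℤ.* (y - y′) ≡ x ℤ.* y - x′ ℤ.* y′
          regroup = solve-∀

  -‿cong-mod : ∀ {x y} → x ≡ y mod n → - x ≡ - y mod n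
  -‿cong-mod {x} {y} (mod∣ d) = mod∣ (subst (+ n ℤ∣.∣_) (regroup x y) (ℤ∣.∣m⇒∣-m d))
    where regroup : ∀ x y → - (x - y) ≡ - x - - y
          regroup = solve-∀

  ^-cong-mod : ∀ {x y} k → x ≡ y mod n → x ^ k ≡ y ^ k mod n
  ^-cong-mod zero    _   = ≡-mod-refl
  ^-cong-mod (suc k) x≡y = *-cong-mod x≡y (^-cong-mod k x≡y)

  ≡0-mod⇒∣ : ∀ {x} → x ≡ + 0 mod n → + n ℤ∣.∣ x
  ≡0-mod⇒∣ {x} (mod∣ d) = subst (+ n ℤ∣.∣_) (ℤ.+-identityʳ x) d

  ∣⇒≡0-mod : ∀ {x} → + n ℤ∣.∣ x → x ≡ + 0 mod n
  ∣⇒≡0-mod {x} d = mod∣ (subst (+ n ℤ∣.∣_) (sym (ℤ.+-identityʳ x)) d)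

  ℕ∣⇒≡0-mod : ∀ {x} → n ∣ x → + x ≡ + 0 mod n
  ℕ∣⇒≡0-mod {x} n∣x = ∣⇒≡0-mod (ℤ∣.∣ᵤ⇒∣ {+ n} {+ x} n∣x)

  ≡0-mod⇒ℕ∣ : ∀ {x} → + x ≡ + 0 mod n → n ∣ x
  ≡0-mod⇒ℕ∣ = ℤ∣.∣⇒∣ᵤ ∘ ≡0-mod⇒∣

  %-mod : ∀ x .{{_ : NonZero n}} → + x ≡ + (x % n) mod n
  %-mod x = mod∣ (ℤ∣.divides (+ (x / n)) (begin
    + x - + (x % n)                          ≡⟨ cong (λ y → + y - + (x % n)) (m≡m%n+[m/n]*n x n) ⟩
    + (x % n ℕ.+ x / n ℕ.* n) - + (x % n)    ≡⟨ cong (_- + (x % n)) (ℤ.pos-+ (x % n) (x / n ℕ.* n)) ⟩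
    + (x % n) + + (x / n ℕ.* n) - + (x % n)  ≡⟨ cancel (+ (x % n)) (+ (x / n ℕ.* n)) ⟩
    + (x / n ℕ.* n)                          ≡⟨ ℤ.pos-* (x / n) n ⟩
    + (x / n) ℤ.* + n                        ∎))
    where open ≡-Reasoning
          cancel : ∀ r y → r + y - r ≡ y
          cancel = solve-∀

mod-setoid : ℕ → Setoid _ _
mod-setoid n = record { isEquivalence = ≡-mod-isEquivalence {n} }

module ≡-mod-Reasoning (n : ℕ) = Relation.Binary.Reasoning.Setoid (mod-setoid n)

∣∧<⇒≡0 : ∀ {m n} → n ∣ m → m < n → m ≡ 0
∣∧<⇒≡0 {zero}  _   _   = refl
∣∧<⇒≡0 {suc m} n∣m m<n = contradiction n∣m (ℕ∣.>⇒∤ m<n)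

<-≡-mod⇒≡ : ∀ {n x y} → x < n → y < n → + x ≡ + y mod n → x ≡ y
<-≡-mod⇒≡ {n} {x} {y} x<n y<n (mod∣ d) =
  ℤ.+-injective (ℤ.i-j≡0⇒i≡j _ _ (ℤ.∣i∣≡0⇒i≡0 (∣∧<⇒≡0 (ℤ∣.∣⇒∣ᵤ d) ∣x-y∣<n)))
  where
  ∣x-y∣<n : ∣ + x - + y ∣ < n
  ∣x-y∣<n = subst (_< n) (cong ∣_∣ (sym (ℤ.m-n≡m⊖n x y))) (ℕ.≤-<-trans (ℤ.∣m⊝n∣≤m⊔n x y) (ℕ.⊔-lub x<n y<n))

%≡%⇒≡-mod : ∀ {n x y} .{{_ : NonZero n}} → x % n ≡ y % n → + x ≡ + y mod n
%≡%⇒≡-mod {n} {x} {y} x%n≡y%n =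
  ≡-mod-trans (%-mod x) (subst (λ r → + r ≡ + y mod n) (sym x%n≡y%n) (≡-mod-sym (%-mod y)))

≡-mod⇒%≡% : ∀ {n x y} .{{_ : NonZero n}} → + x ≡ + y mod n → x % n ≡ y % n
≡-mod⇒%≡% {n} {x} {y} x≡y =
  <-≡-mod⇒≡ (m%n<n x n) (m%n<n y n) (≡-mod-trans (≡-mod-sym (%-mod x)) (≡-mod-trans x≡y (%-mod y)))

module _ {p : ℕ} (p-prime : Prime p) where

  1≢0-mod : ¬ + 1 ≡ + 0 mod p
  1≢0-mod 1≡0 = ℕ.nonTrivial⇒≢1 {{prime⇒nonTrivial p-prime}} (ℕ∣.∣1⇒≡1 (≡0-mod⇒ℕ∣ 1≡0))

  euclid-mod : ∀ {x y} → x ℤ.* y ≡ + 0 mod p → x ≡ + 0 mod p ⊎ y ≡ + 0 mod p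
  euclid-mod {x} {y} xy≡0 with euclidsLemma ∣ x ∣ ∣ y ∣ p-prime
                                 (subst (p ∣_) (ℤ.abs-* x y) (ℤ∣.∣⇒∣ᵤ (≡0-mod⇒∣ xy≡0)))
  ... | inj₁ p∣x = inj₁ (∣⇒≡0-mod (ℤ∣.∣ᵤ⇒∣ p∣x))
  ... | inj₂ p∣y = inj₂ (∣⇒≡0-mod (ℤ∣.∣ᵤ⇒∣ p∣y))

  *-cancelʳ-mod : ∀ {x y c} → ¬ c ≡ + 0 mod p → x ℤ.* c ≡ y ℤ.* c mod p → x ≡ y mod p
  *-cancelʳ-mod {x} {y} {c} c≢0 (mod∣ d)
    with euclid-mod (∣⇒≡0-mod (subst (+ p ℤ∣.∣_) (factor x y c) d))
    where factor : ∀ x y c → x ℤ.* c - y ℤ.* c ≡ (x - y) ℤ.* c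
          factor = solve-∀
  ... | inj₁ x-y≡0 = mod∣ (≡0-mod⇒∣ x-y≡0)
  ... | inj₂ c≡0   = contradiction c≡0 c≢0

  square-≡-mod : ∀ {x y} → x ℤ.* x ≡ y ℤ.* y mod p → x ≡ y mod p ⊎ x ≡ - y mod p
  square-≡-mod {x} {y} (mod∣ d) with euclid-mod (∣⇒≡0-mod (subst (+ p ℤ∣.∣_) (factor x y) d))
    where factor : ∀ x y → x ℤ.* x - y ℤ.* y ≡ (x - y) ℤ.* (x + y)
          factor = solve-∀
  ... | inj₁ x-y≡0 = inj₁ (mod∣ (≡0-mod⇒∣ x-y≡0))
  ... | inj₂ x+y≡0 = inj₂ (mod∣ (subst (+ p ℤ∣.∣_) (plus x y) (≡0-mod⇒∣ x+y≡0)))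
    where plus : ∀ x y → x + y ≡ x - - y
          plus = solve-∀

-- Finite sums and products

injective⇒surjective : ∀ {n} {f : Fin n → Fin n} → Injective _≡_ _≡_ f → ∀ j → ∃ λ i → f i ≡ j
injective⇒surjective {suc n} {f} f-inj j with Fin.any? (λ i → f i Fin.≟ j)
... | yes hit = hit
... | no miss = contradiction (Fin.injective⇒≤ f-punched-inj) ℕ.1+n≰n
  where
  j≢f : ∀ i → j ≢ f i
  j≢f i j≡fi = miss (i , sym j≡fi)
  f-punched : Fin (suc n) → Fin n
  f-punched i = punchOut (j≢f i)
  f-punched-inj : Injective _≡_ _≡_ f-punched
  f-punched-inj {i} {i′} = f-inj ∘ Fin.punchOut-injective (j≢f i) (j≢f i′)

injective⇒permutation : ∀ {n} {f : Fin n → Fin n} → Injective _≡_ _≡_ f → Permutation n n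
injective⇒permutation {f = f} f-inj =
  permutation f (proj₁ ∘ surj) (proj₂ ∘ surj) (λ i → f-inj (proj₂ (surj (f i))))
  where surj = injective⇒surjective f-inj

module _ {c ℓ} (M : CommutativeMonoid c ℓ) where
  open CommutativeMonoid M using (Carrier; _≈_) renaming (sym to ≈-sym)
  open Sum M using (sum; sum-permute)

  sum-reindex-injective : ∀ {n} (g : Vector Carrier n) {f : Fin n → Fin n} →
                          Injective _≡_ _≡_ f → sum (g ∘ f) ≈ sum g
  sum-reindex-injective g f-inj = ≈-sym (sum-permute g (injective⇒permutation f-inj))

foldr-homo : ∀ {a b} {A : Set a} {B : Set b} (φ : A → B)
             {_∙_ : A → A → A} {_∘′_ : B → B → B} {ε : A} {ε′ : B} →
             φ ε ≡ ε′ → (∀ x y → φ (x ∙ y) ≡ φ x ∘′ φ y) →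
             ∀ {n} (f : Vector A n) → φ (Vector.foldr _∙_ ε f) ≡ Vector.foldr _∘′_ ε′ (φ ∘ f)
foldr-homo φ ε-homo ∙-homo {zero}  f = ε-homo
foldr-homo φ {_∘′_ = _∘′_} ε-homo ∙-homo {suc n} f =
  trans (∙-homo _ _) (cong (φ (f zero) ∘′_) (foldr-homo φ ε-homo ∙-homo (f ∘ suc)))

sgn : Parity → ℤ
sgn 0ℙ = + 1
sgn 1ℙ = - + 1

sgn-homo : ∀ x y → sgn (x ℙ.+ y) ≡ sgn x ℤ.* sgn y
sgn-homo 0ℙ y  = sym (ℤ.*-identityˡ (sgn y))
sgn-homo 1ℙ 0ℙ = refl
sgn-homo 1ℙ 1ℙ = refl

sgn-square : ∀ x → sgn x ℤ.* sgn x ≡ + 1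
sgn-square 0ℙ = refl
sgn-square 1ℙ = refl

sgn-injective-mod : ∀ {p x y} → 2 < p → sgn x ≡ sgn y mod p → x ≡ y
sgn-injective-mod {x = 0ℙ} {0ℙ} _   _        = refl
sgn-injective-mod {x = 1ℙ} {1ℙ} _   _        = refl
-- 1 - (-1) and 2 - 0 are the same integer, so d says that p divides 2.
sgn-injective-mod {x = 0ℙ} {1ℙ} 2<p (mod∣ d) =
  contradiction (<-≡-mod⇒≡ 2<p (ℕ.<-trans (s≤s z≤n) 2<p) (mod∣ {x = + 2} {y = + 0} d)) λ ()
sgn-injective-mod {x = 1ℙ} {0ℙ} 2<p d        = sym (sgn-injective-mod 2<p (≡-mod-sym d))

sgn-flip-mod : ∀ {p} ε {x y} → sgn ε ℤ.* x ≡ y mod p → x ≡ sgn ε ℤ.* y mod p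
sgn-flip-mod ε {x} {y} εx≡y = ≡-mod-trans (≡⇒≡-mod (begin
  x                         ≡⟨ ℤ.*-identityˡ x ⟨
  + 1 ℤ.* x                 ≡⟨ cong (ℤ._* x) (sgn-square ε) ⟨
  sgn ε ℤ.* sgn ε ℤ.* x     ≡⟨ ℤ.*-assoc (sgn ε) (sgn ε) x ⟩
  sgn ε ℤ.* (sgn ε ℤ.* x)   ∎)) (*-cong-mod (≡-mod-refl {x = sgn ε}) εx≡y)
  where open ≡-Reasoning

-1^≡sgn-parity : ∀ n → (- + 1) ^ n ≡ sgn (parity n)
-1^≡sgn-parity zero          = refl
-1^≡sgn-parity (suc zero)    = refl
-1^≡sgn-parity (suc (suc n)) = trans (cancel ((- + 1) ^ n)) (-1^≡sgn-parity n)
  where cancel : ∀ x → - + 1 ℤ.* (- + 1 ℤ.* x) ≡ x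
        cancel = solve-∀

^-distribʳ-* : ∀ x y n → (x ℤ.* y) ^ n ≡ x ^ n ℤ.* y ^ n
^-distribʳ-* x y zero    = refl
^-distribʳ-* x y (suc n) = trans (cong (x ℤ.* y ℤ.*_) (^-distribʳ-* x y n)) (regroup x y (x ^ n) (y ^ n))
  where regroup : ∀ a b c d → a ℤ.* b ℤ.* (c ℤ.* d) ≡ a ℤ.* c ℤ.* (b ℤ.* d)
        regroup = solve-∀

∏-sgn : ∀ {n} (ε : Fin n → Parity) → ∏ (sgn ∘ ε) ≡ sgn (∑ℙ ε)
∏-sgn ε = sym (foldr-homo sgn refl sgn-homo ε)

∏-^ : ∀ {n} (f : Fin n → ℤ) k → ∏ f ^ k ≡ ∏ (λ i → f i ^ k)
∏-^ f k = foldr-homo (_^ k) (ℤ.^-zeroˡ k) (λ x y → ^-distribʳ-* x y k) f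

∏-const : ∀ n x → ∏ {n} (λ _ → x) ≡ x ^ n
∏-const zero    x = refl
∏-const (suc n) x = cong (x ℤ.*_) (∏-const n x)

∏-cong-mod : ∀ {p n} {f g : Fin n → ℤ} → (∀ i → f i ≡ g i mod p) → ∏ f ≡ ∏ g mod p
∏-cong-mod {n = zero}  _   = ≡-mod-refl
∏-cong-mod {n = suc n} f≡g = *-cong-mod (f≡g zero) (∏-cong-mod (f≡g ∘ suc))

∏-≢0-mod : ∀ {p n} {f : Fin n → ℤ} → Prime p → (∀ i → ¬ f i ≡ + 0 mod p) → ¬ ∏ f ≡ + 0 mod p
∏-≢0-mod {n = zero}  p-prime _   = 1≢0-mod p-prime
∏-≢0-mod {n = suc n} p-prime f≢0 ∏≡0 with euclid-mod p-prime ∏≡0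
... | inj₁ f₀≡0   = f≢0 zero f₀≡0
... | inj₂ rest≡0 = ∏-≢0-mod p-prime (f≢0 ∘ suc) rest≡0

ℙ-+≡0⇒≡ : ∀ x y → x ℙ.+ y ≡ 0ℙ → x ≡ y
ℙ-+≡0⇒≡ 0ℙ 0ℙ _ = refl
ℙ-+≡0⇒≡ 1ℙ 1ℙ _ = refl

ℙ-+≡1⇒≡+1 : ∀ x y → x ℙ.+ y ≡ 1ℙ → x ≡ y ℙ.+ 1ℙ
ℙ-+≡1⇒≡+1 0ℙ 1ℙ _ = refl
ℙ-+≡1⇒≡+1 1ℙ 0ℙ _ = refl

parity-2h+1 : ∀ h → parity (suc (h ℕ.+ h)) ≡ 1ℙ
parity-2h+1 h = trans (ℙ.+-homo-+ 1 (h ℕ.+ h)) (cong (1ℙ ℙ.+_) (trans (ℙ.+-homo-+ h h) (ℙ.p+p≡0ℙ (parity h))))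

-- Gauss's lemma

pos : ∀ {h} → Fin h → ℕ
pos k = suc (toℕ k)

pos-injective : ∀ {h} {k l : Fin h} → pos k ≡ pos l → k ≡ l
pos-injective = Fin.toℕ-injective ∘ ℕ.suc-injective

pos⁻¹ : ∀ {h y} → 1 ≤ y → y ≤ h → Fin h
pos⁻¹ {y = suc y} _ y<h = fromℕ< y<h

pos∘pos⁻¹ : ∀ {h y} (1≤y : 1 ≤ y) (y≤h : y ≤ h) → pos (pos⁻¹ 1≤y y≤h) ≡ y
pos∘pos⁻¹ {y = suc y} _ y<h = cong suc (Fin.toℕ-fromℕ< y<h)

inUpperHalf : ℕ → ℕ → Parity
inUpperHalf h x with h <? x
... | yes _ = 1ℙ
... | no  _ = 0ℙ

gaussParity : (p h a : ℕ) .{{_ : NonZero p}} → Parity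
gaussParity p h a = ∑ℙ λ (k : Fin h) → inUpperHalf h (pos k ℕ.* a % p)

module Gauss {p h : ℕ} (p-prime : Prime p) (p≡2h+1 : p ≡ suc (h ℕ.+ h)) where

  instance
    p-nonZero : NonZero p
    p-nonZero = subst NonZero (sym p≡2h+1) _

  2h<p : h ℕ.+ h < p
  2h<p = subst (h ℕ.+ h <_) (sym p≡2h+1) ℕ.≤-refl

  h<p : h < p
  h<p = ℕ.≤-<-trans (ℕ.m≤m+n h h) 2h<p

  1≤h : 1 ≤ h
  1≤h = ℕ.n≢0⇒n>0 λ h≡0 →
    ℕ.nonTrivial⇒≢1 {{prime⇒nonTrivial p-prime}} (trans p≡2h+1 (cong (λ h → suc (h ℕ.+ h)) h≡0))

  2<p : 2 < p
  2<p = ℕ.<-≤-trans (s≤s (ℕ.+-mono-≤ 1≤h 1≤h)) 2h<p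

  parity-p : parity p ≡ 1ℙ
  parity-p = trans (cong parity p≡2h+1) (parity-2h+1 h)

  pos<p : (k : Fin h) → pos k < p
  pos<p k = ℕ.≤-<-trans (Fin.toℕ<n k) h<p

  pos≢0-mod : (k : Fin h) → ¬ + pos k ≡ + 0 mod p
  pos≢0-mod k pos≡0 = contradiction (<-≡-mod⇒≡ (pos<p k) (ℕ.<-trans (s≤s z≤n) 2<p) pos≡0) λ ()

  fold : ℕ → ℕ
  fold x with h <? x
  ... | yes _ = p ∸ x
  ... | no  _ = x

  fold≡-mod : ∀ {x} → x ≤ p → + x ≡ sgn (inUpperHalf h x) ℤ.* + fold x mod p
  fold≡-mod {x} x≤p with h <? x
  ... | no  _ = ≡⇒≡-mod (sym (ℤ.*-identityˡ (+ x)))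
  ... | yes _ = mod∣ (ℤ∣.divides (+ 1) (begin
    + x - - + 1 ℤ.* + (p ∸ x)  ≡⟨ cong (λ y → + x - y) (ℤ.-1*i≡-i (+ (p ∸ x))) ⟩
    + x - - + (p ∸ x)          ≡⟨ cong (λ y → + x + y) (ℤ.neg-involutive (+ (p ∸ x))) ⟩
    + x + + (p ∸ x)            ≡⟨ ℤ.pos-+ x (p ∸ x) ⟨
    + (x ℕ.+ (p ∸ x))          ≡⟨ cong +_ (ℕ.m+[n∸m]≡n x≤p) ⟩
    + p                        ≡⟨ ℤ.*-identityˡ (+ p) ⟨
    + 1 ℤ.* + p                ∎))
    where open ≡-Reasoning

  fold-parity : ∀ {x} → x ≤ p → parity x ≡ parity (fold x) ℙ.+ inUpperHalf h x
  fold-parity {x} x≤p with h <? x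
  ... | no  _ = sym (ℙ.+-identityʳ (parity x))
  ... | yes _ = ℙ-+≡1⇒≡+1 (parity x) (parity (p ∸ x)) (begin
    parity x ℙ.+ parity (p ∸ x)  ≡⟨ ℙ.+-homo-+ x (p ∸ x) ⟨
    parity (x ℕ.+ (p ∸ x))       ≡⟨ cong parity (ℕ.m+[n∸m]≡n x≤p) ⟩
    parity p                     ≡⟨ parity-p ⟩
    1ℙ                           ∎)
    where open ≡-Reasoning

  fold-bounds : ∀ {x} → 0 < x → x < p → 1 ≤ fold x × fold x ≤ h
  fold-bounds {x} 0<x x<p with h <? x
  ... | no  x≯h = 0<x , ℕ.≮⇒≥ x≯h
  ... | yes h<x = ℕ.m<n⇒0<n∸m x<p , ℕ.≤-trans (ℕ.∸-monoʳ-≤ p h<x) (ℕ.≤-reflexive p∸[1+h]≡h)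
    where p∸[1+h]≡h : p ∸ suc h ≡ h
          p∸[1+h]≡h = trans (cong (_∸ suc h) p≡2h+1) (ℕ.m+n∸m≡n h h)

  half-system-distinct : ∀ {k l : Fin h} ε → + pos k ≡ sgn ε ℤ.* + pos l mod p → k ≡ l
  half-system-distinct {k} {l} 0ℙ k≡l =
    pos-injective (<-≡-mod⇒≡ (pos<p k) (pos<p l) (≡-mod-trans k≡l (≡⇒≡-mod (ℤ.*-identityˡ (+ pos l)))))
  half-system-distinct {k} {l} 1ℙ k≡-l = contradiction k+l≡0 λ ()
    where
    k+l≡0 : pos k ℕ.+ pos l ≡ 0
    k+l≡0 = <-≡-mod⇒≡ (ℕ.≤-<-trans (ℕ.+-mono-≤ (Fin.toℕ<n k) (Fin.toℕ<n l)) 2h<p) (ℕ.<-trans (s≤s z≤n) 2<p)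
      (≡-mod-trans (≡⇒≡-mod (ℤ.pos-+ (pos k) (pos l)))
        (≡-mod-trans (+-cong-mod k≡-l (≡-mod-refl {x = + pos l})) (≡⇒≡-mod (cancel (+ pos l)))))
      where cancel : ∀ y → - + 1 ℤ.* y + y ≡ + 0
            cancel = solve-∀

  module _ {a : ℕ} (p∤a : ¬ p ∣ a) where

    private
      r : Fin h → ℕ
      r k = pos k ℕ.* a % p

      ε : Fin h → Parity
      ε k = inUpperHalf h (r k)

      a≢0 : ¬ + a ≡ + 0 mod p
      a≢0 = p∤a ∘ ≡0-mod⇒ℕ∣

      pos·a≢0 : ∀ k → ¬ + (pos k ℕ.* a) ≡ + 0 mod p
      pos·a≢0 k ka≡0 with euclid-mod p-prime (subst (_≡ + 0 mod p) (ℤ.pos-* (pos k) a) ka≡0)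
      ... | inj₁ k≡0 = pos≢0-mod k k≡0
      ... | inj₂ a≡0 = a≢0 a≡0

      0<r : ∀ k → 0 < r k
      0<r k = ℕ.n≢0⇒n>0 λ r≡0 → pos·a≢0 k (≡-mod-trans (%-mod (pos k ℕ.* a)) (≡⇒≡-mod (cong +_ r≡0)))

      fold-r-bounds : ∀ k → 1 ≤ fold (r k) × fold (r k) ≤ h
      fold-r-bounds k = fold-bounds (0<r k) (m%n<n (pos k ℕ.* a) p)

      s : Fin h → Fin h
      s k = pos⁻¹ (proj₁ (fold-r-bounds k)) (proj₂ (fold-r-bounds k))

      pos-s : ∀ k → pos (s k) ≡ fold (r k)
      pos-s k = pos∘pos⁻¹ (proj₁ (fold-r-bounds k)) (proj₂ (fold-r-bounds k))

      pos·a≡±pos-s : ∀ k → + (pos k ℕ.* a) ≡ sgn (ε k) ℤ.* + pos (s k) mod p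
      pos·a≡±pos-s k = ≡-mod-trans (%-mod (pos k ℕ.* a))
        (subst (λ y → + r k ≡ sgn (ε k) ℤ.* + y mod p) (sym (pos-s k)) (fold≡-mod (ℕ.<⇒≤ (m%n<n (pos k ℕ.* a) p))))

      s-injective : Injective _≡_ _≡_ s
      s-injective {k} {l} sk≡sl = half-system-distinct (ε k ℙ.+ ε l) pos-k≡±pos-l
        where
        ±pos·a≡pos-s : ∀ k → sgn (ε k) ℤ.* (+ pos k ℤ.* + a) ≡ + pos (s k) mod p
        ±pos·a≡pos-s k = ≡-mod-sym (sgn-flip-mod (ε k) (≡-mod-sym
          (subst (_≡ sgn (ε k) ℤ.* + pos (s k) mod p) (ℤ.pos-* (pos k) a) (pos·a≡±pos-s k))))
        ±pos-k≡±pos-l : sgn (ε k) ℤ.* + pos k ≡ sgn (ε l) ℤ.* + pos l mod p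
        ±pos-k≡±pos-l = *-cancelʳ-mod p-prime a≢0 (subst₂ (_≡_mod p)
          (sym (ℤ.*-assoc (sgn (ε k)) _ _)) (sym (ℤ.*-assoc (sgn (ε l)) _ _))
          (≡-mod-trans (±pos·a≡pos-s k)
            (subst (_≡ sgn (ε l) ℤ.* (+ pos l ℤ.* + a) mod p) (cong (+_ ∘ pos) (sym sk≡sl)) (≡-mod-sym (±pos·a≡pos-s l)))))
        pos-k≡±pos-l : + pos k ≡ sgn (ε k ℙ.+ ε l) ℤ.* + pos l mod p
        pos-k≡±pos-l = subst (+ pos k ≡_mod p)
          (trans (sym (ℤ.*-assoc (sgn (ε k)) _ _)) (cong (ℤ._* + pos l) (sym (sgn-homo (ε k) (ε l)))))
          (sgn-flip-mod (ε k) ±pos-k≡±pos-l)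

    -- k a ≡ ±s(k) with s a permutation of 1, …, h: compare the products over k.
    gauss-lemma : (+ a) ^ h ≡ sgn (gaussParity p h a) mod p
    gauss-lemma = *-cancelʳ-mod p-prime (∏-≢0-mod p-prime pos≢0-mod) (begin
      (+ a) ^ h ℤ.* ∏ +pos                              ≡⟨ ℤ.*-comm _ (∏ +pos) ⟩
      ∏ +pos ℤ.* (+ a) ^ h                              ≡⟨ cong (∏ +pos ℤ.*_) (∏-const h (+ a)) ⟨
      ∏ +pos ℤ.* ∏ (λ (_ : Fin h) → + a)                ≡⟨ ∏-distrib-* +pos (λ _ → + a) ⟨
      ∏ (λ (k : Fin h) → + pos k ℤ.* + a)               ≡⟨ ∏-cong {h} (λ k → ℤ.pos-* (pos k) a) ⟨
      ∏ (λ (k : Fin h) → + (pos k ℕ.* a))               ≈⟨ ∏-cong-mod pos·a≡±pos-s ⟩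
      ∏ (λ (k : Fin h) → sgn (ε k) ℤ.* + pos (s k))     ≡⟨ ∏-distrib-* (sgn ∘ ε) (+pos ∘ s) ⟩
      ∏ (sgn ∘ ε) ℤ.* ∏ (+pos ∘ s)                      ≡⟨ cong₂ ℤ._*_ (∏-sgn ε) (∏+pos∘s≡∏+pos) ⟩
      sgn (gaussParity p h a) ℤ.* ∏ +pos                ∎)
      where
      open ≡-mod-Reasoning p
      +pos : Fin h → ℤ
      +pos k = + pos k
      ∏+pos∘s≡∏+pos : ∏ (+pos ∘ s) ≡ ∏ +pos
      ∏+pos∘s≡∏+pos = sum-reindex-injective ℤ.*-1-commutativeMonoid +pos s-injective

    -- Reduce k a = r k + p q k modulo 2 and sum over k; the parities of the s k cancel
    -- against those of the k, as s permutes 1, …, h.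
    eisenstein : parity a ≡ 1ℙ → gaussParity p h a ≡ parity (∑ℕ λ (k : Fin h) → pos k ℕ.* a / p)
    eisenstein a-odd = trans (ℙ-+≡0⇒≡ (∑ℙ ε) (∑ℙ (parity ∘ q)) (sym (ℙ.+-cancelˡ-≡ X _ _ X+0≡X+μ+Q)))
                             (sym (foldr-homo parity refl ℙ.+-homo-+ q))
      where
      open ≡-Reasoning
      q : Fin h → ℕ
      q k = pos k ℕ.* a / p
      X : Parity
      X = ∑ℙ {h} (parity ∘ pos)
      parity-pos : ∀ k → parity (pos k) ≡ parity (pos (s k)) ℙ.+ ε k ℙ.+ parity (q k)
      parity-pos k = begin
        parity (pos k)                                 ≡⟨ ℙ.*-identityʳ (parity (pos k)) ⟨
        parity (pos k) ℙ.* 1ℙ                          ≡⟨ cong (parity (pos k) ℙ.*_) a-odd ⟨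
        parity (pos k) ℙ.* parity a                    ≡⟨ ℙ.*-homo-* (pos k) a ⟨
        parity (pos k ℕ.* a)                           ≡⟨ cong parity (m≡m%n+[m/n]*n (pos k ℕ.* a) p) ⟩
        parity (r k ℕ.+ q k ℕ.* p)                     ≡⟨ ℙ.+-homo-+ (r k) (q k ℕ.* p) ⟩
        parity (r k) ℙ.+ parity (q k ℕ.* p)            ≡⟨ cong (parity (r k) ℙ.+_) (ℙ.*-homo-* (q k) p) ⟩
        parity (r k) ℙ.+ (parity (q k) ℙ.* parity p)   ≡⟨ cong (λ x → parity (r k) ℙ.+ (parity (q k) ℙ.* x)) parity-p ⟩
        parity (r k) ℙ.+ (parity (q k) ℙ.* 1ℙ)         ≡⟨ cong (parity (r k) ℙ.+_) (ℙ.*-identityʳ (parity (q k))) ⟩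
        parity (r k) ℙ.+ parity (q k)                  ≡⟨ cong (ℙ._+ parity (q k)) (fold-parity (ℕ.<⇒≤ (m%n<n (pos k ℕ.* a) p))) ⟩
        parity (fold (r k)) ℙ.+ ε k ℙ.+ parity (q k)   ≡⟨ cong (λ x → parity x ℙ.+ ε k ℙ.+ parity (q k)) (pos-s k) ⟨
        parity (pos (s k)) ℙ.+ ε k ℙ.+ parity (q k)    ∎
      X+0≡X+μ+Q : X ℙ.+ 0ℙ ≡ X ℙ.+ (∑ℙ ε ℙ.+ ∑ℙ (parity ∘ q))
      X+0≡X+μ+Q = begin
        X ℙ.+ 0ℙ
          ≡⟨ ℙ.+-identityʳ X ⟩
        X
          ≡⟨ ∑ℙ-cong {h} parity-pos ⟩
        ∑ℙ (λ k → parity (pos (s k)) ℙ.+ ε k ℙ.+ parity (q k))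
          ≡⟨ ∑ℙ-distrib-+ (λ k → parity (pos (s k)) ℙ.+ ε k) (parity ∘ q) ⟩
        ∑ℙ (λ k → parity (pos (s k)) ℙ.+ ε k) ℙ.+ ∑ℙ (parity ∘ q)
          ≡⟨ cong (ℙ._+ ∑ℙ (parity ∘ q)) (∑ℙ-distrib-+ (parity ∘ pos ∘ s) ε) ⟩
        ∑ℙ (parity ∘ pos ∘ s) ℙ.+ ∑ℙ ε ℙ.+ ∑ℙ (parity ∘ q)
          ≡⟨ cong (λ x → x ℙ.+ ∑ℙ ε ℙ.+ ∑ℙ (parity ∘ q)) (sum-reindex-injective ℙ.+-0-commutativeMonoid (parity ∘ pos) s-injective) ⟩
        X ℙ.+ ∑ℙ ε ℙ.+ ∑ℙ (parity ∘ q)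
          ≡⟨ ℙ.+-assoc X (∑ℙ ε) (∑ℙ (parity ∘ q)) ⟩
        X ℙ.+ (∑ℙ ε ℙ.+ ∑ℙ (parity ∘ q))
          ∎

-- Quadratic reciprocity

∑ℕ-const : ∀ n c → ∑ℕ {n} (λ _ → c) ≡ n ℕ.* c
∑ℕ-const zero    c = refl
∑ℕ-const (suc n) c = cong (c ℕ.+_) (∑ℕ-const n c)

𝟙[_≤_] : ℕ → ℕ → ℕ
𝟙[ m ≤ n ] = if m ≤ᵇ n then 1 else 0

count-≤ : ∀ N Y → ∑ℕ (λ (l : Fin N) → 𝟙[ pos l ≤ Y ]) ≡ N ⊓ Y
count-≤ zero    Y       = refl
count-≤ (suc N) zero    = trans (count-≤ N zero) (ℕ.⊓-zeroʳ N)
count-≤ (suc N) (suc Y) = cong suc (count-≤ N Y)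

𝟙-cong : ∀ {m n m′ n′} → (m ≤ n → m′ ≤ n′) → (m′ ≤ n′ → m ≤ n) → 𝟙[ m ≤ n ] ≡ 𝟙[ m′ ≤ n′ ]
𝟙-cong {m} {n} {m′} {n′} to from with m ≤ᵇ n | ℕ.≤ᵇ-reflects-≤ m n | m′ ≤ᵇ n′ | ℕ.≤ᵇ-reflects-≤ m′ n′
... | true  | _       | true  | _         = refl
... | false | _       | false | _         = refl
... | true  | ofʸ m≤n | false | ofⁿ m′≰n′ = contradiction (to m≤n) m′≰n′
... | false | ofⁿ m≰n | true  | ofʸ m′≤n′ = contradiction (from m′≤n′) m≰n

𝟙-total : ∀ {m n} → m ≢ n → 𝟙[ m ≤ n ] ℕ.+ 𝟙[ n ≤ m ] ≡ 1
𝟙-total {m} {n} m≢n with m ≤ᵇ n | ℕ.≤ᵇ-reflects-≤ m n | n ≤ᵇ m | ℕ.≤ᵇ-reflects-≤ n m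
... | true  | _       | false | _       = refl
... | false | _       | true  | _       = refl
... | true  | ofʸ m≤n | true  | ofʸ n≤m = contradiction (ℕ.≤-antisym m≤n n≤m) m≢n
... | false | ofⁿ m≰n | false | ofⁿ n≰m = contradiction (ℕ.≰⇒≥ m≰n) n≰m

/-as-count : ∀ {p} .{{_ : NonZero p}} N X → X / p ≤ N → X / p ≡ ∑ℕ (λ (l : Fin N) → 𝟙[ pos l ℕ.* p ≤ X ])
/-as-count {p} N X X/p≤N = sym (begin
  ∑ℕ (λ (l : Fin N) → 𝟙[ pos l ℕ.* p ≤ X ])  ≡⟨ ∑ℕ-cong {N} (λ l → 𝟙-cong (≤/ (pos l)) (/≤ (pos l))) ⟩
  ∑ℕ (λ (l : Fin N) → 𝟙[ pos l ≤ X / p ])    ≡⟨ count-≤ N (X / p) ⟩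
  N ⊓ (X / p)                                ≡⟨ ℕ.m≥n⇒m⊓n≡n X/p≤N ⟩
  X / p                                      ∎)
  where
  open ≡-Reasoning
  ≤/ : ∀ l → l ℕ.* p ≤ X → l ≤ X / p
  ≤/ l lp≤X = subst (_≤ X / p) (m*n/n≡m l p) (/-monoˡ-≤ p lp≤X)
  /≤ : ∀ l → l ≤ X / p → l ℕ.* p ≤ X
  /≤ l l≤X/p = ℕ.≤-trans (ℕ.*-monoˡ-≤ p l≤X/p) (m/n*n≤m X p)

prime∤prime : ∀ {p q} → Prime p → Prime q → p ≢ q → ¬ p ∣ q
prime∤prime p-prime q-prime p≢q p∣q with prime⇒irreducible q-prime p∣q
... | inj₁ p≡1 = ℕ.nonTrivial⇒≢1 {{prime⇒nonTrivial p-prime}} p≡1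
... | inj₂ p≡q = p≢q p≡q

p∤pos·q : ∀ {p q} h → Prime p → Prime q → p ≡ suc (h ℕ.+ h) → p ≢ q → (k : Fin h) → ¬ p ∣ pos k ℕ.* q
p∤pos·q h p-prime q-prime p≡2h+1 p≢q k p∣kq with euclidsLemma (pos k) _ p-prime p∣kq
... | inj₁ p∣k = ℕ.<⇒≱ (Gauss.pos<p {h = h} p-prime p≡2h+1 k) (ℕ∣.∣⇒≤ p∣k)
... | inj₂ p∣q = prime∤prime p-prime q-prime p≢q p∣q

pos·q/p≤h′ : ∀ {p h q h′} .{{_ : NonZero p}} → p ≡ suc (h ℕ.+ h) → q ≡ suc (h′ ℕ.+ h′) →
             (k : Fin h) → pos k ℕ.* q / p ≤ h′
pos·q/p≤h′ {p} {h} {q} {h′} refl refl k =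
  ℕ.s≤s⁻¹ (m<n*o⇒m/o<n (ℕ.≤-<-trans (ℕ.*-monoˡ-≤ q (Fin.toℕ<n k)) hq<[h′+1]p))
  where
  hq<[h′+1]p : h ℕ.* q < suc h′ ℕ.* p
  hq<[h′+1]p = subst (h ℕ.* q <_) (sym (expand h h′)) (ℕ.m<m+n (h ℕ.* q) (s≤s z≤n))
    where expand : ∀ h h′ → suc h′ ℕ.* suc (h ℕ.+ h) ≡ h ℕ.* suc (h′ ℕ.+ h′) ℕ.+ suc (h ℕ.+ h′)
          expand = ℕ-Solver.solve-∀

module _ {p h q h′ : ℕ} (p-prime : Prime p) (q-prime : Prime q)
         (p≡2h+1 : p ≡ suc (h ℕ.+ h)) (q≡2h′+1 : q ≡ suc (h′ ℕ.+ h′)) (p≢q : p ≢ q) where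

  private
    module Gp = Gauss {h = h} p-prime p≡2h+1
    module Gq = Gauss {h = h′} q-prime q≡2h′+1
    instance
      p-nonZero = Gp.p-nonZero
      q-nonZero = Gq.p-nonZero

  -- Both sides count the lattice points of [1, h] × [1, h′], none of which lies on the
  -- line q k = p l.
  lattice-count : ∑ℕ (λ (k : Fin h) → pos k ℕ.* q / p) ℕ.+ ∑ℕ (λ (l : Fin h′) → pos l ℕ.* p / q) ≡ h ℕ.* h′
  lattice-count = begin
    ∑ℕ (λ (k : Fin h) → pos k ℕ.* q / p) ℕ.+ ∑ℕ (λ (l : Fin h′) → pos l ℕ.* p / q)
      ≡⟨ cong₂ ℕ._+_ (∑ℕ-cong {h} λ k → /-as-count h′ (pos k ℕ.* q) (pos·q/p≤h′ p≡2h+1 q≡2h′+1 k))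
                     (∑ℕ-cong {h′} λ l → /-as-count h (pos l ℕ.* p) (pos·q/p≤h′ q≡2h′+1 p≡2h+1 l)) ⟩
    ∑ℕ (λ k → ∑ℕ (below k)) ℕ.+ ∑ℕ (λ l → ∑ℕ (λ k → above k l))
      ≡⟨ cong (∑ℕ (λ k → ∑ℕ (below k)) ℕ.+_) (∑ℕ-comm (λ l k → above k l)) ⟩
    ∑ℕ (λ k → ∑ℕ (below k)) ℕ.+ ∑ℕ (λ k → ∑ℕ (above k))
      ≡⟨ ∑ℕ-distrib-+ (λ k → ∑ℕ (below k)) (λ k → ∑ℕ (above k)) ⟨
    ∑ℕ (λ k → ∑ℕ (below k) ℕ.+ ∑ℕ (above k))
      ≡⟨ ∑ℕ-cong {h} (λ k → ∑ℕ-distrib-+ (below k) (above k)) ⟨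
    ∑ℕ (λ k → ∑ℕ (λ l → below k l ℕ.+ above k l))
      ≡⟨ ∑ℕ-cong {h} (λ k → trans (∑ℕ-cong {h′} (λ l → 𝟙-total (lp≢kq k l))) (∑ℕ-const h′ 1)) ⟩
    ∑ℕ (λ (k : Fin h) → h′ ℕ.* 1)
      ≡⟨ ∑ℕ-const h (h′ ℕ.* 1) ⟩
    h ℕ.* (h′ ℕ.* 1)
      ≡⟨ cong (h ℕ.*_) (ℕ.*-identityʳ h′) ⟩
    h ℕ.* h′
      ∎
    where
    open ≡-Reasoning
    below above : Fin h → Fin h′ → ℕ
    below k l = 𝟙[ pos l ℕ.* p ≤ pos k ℕ.* q ]
    above k l = 𝟙[ pos k ℕ.* q ≤ pos l ℕ.* p ]
    lp≢kq : ∀ k l → pos l ℕ.* p ≢ pos k ℕ.* q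
    lp≢kq k l lp≡kq = p∤pos·q h p-prime q-prime p≡2h+1 p≢q k (divides (pos l) (sym lp≡kq))

  quadratic-reciprocity : gaussParity p h q ℙ.+ gaussParity q h′ p ≡ parity h ℙ.* parity h′
  quadratic-reciprocity = begin
    gaussParity p h q ℙ.+ gaussParity q h′ p
      ≡⟨ cong₂ ℙ._+_ (Gp.eisenstein (prime∤prime p-prime q-prime p≢q) Gq.parity-p)
                     (Gq.eisenstein (prime∤prime q-prime p-prime (p≢q ∘ sym)) Gp.parity-p) ⟩
    parity S ℙ.+ parity S′
      ≡⟨ ℙ.+-homo-+ S S′ ⟨
    parity (S ℕ.+ S′)
      ≡⟨ cong parity lattice-count ⟩
    parity (h ℕ.* h′)
      ≡⟨ ℙ.*-homo-* h h′ ⟩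
    parity h ℙ.* parity h′
      ∎
    where
    open ≡-Reasoning
    S S′ : ℕ
    S  = ∑ℕ (λ (k : Fin h) → pos k ℕ.* q / p)
    S′ = ∑ℕ (λ (l : Fin h′) → pos l ℕ.* p / q)

-- Euler's criterion

-- monic (c₀ ∷ … ∷ cₙ₋₁ ∷ []) x = c₀ + x (c₁ + ⋯ + x (cₙ₋₁ + x)), the monic polynomial of
-- degree n with lower coefficients c₀, …, cₙ₋₁.
monic : ∀ {n} → Vec ℤ n → ℤ → ℤ
monic []       x = + 1
monic (c ∷ cs) x = c + x ℤ.* monic cs x

monic-factor : ∀ {n} (cs : Vec ℤ (suc n)) r →
               ∃ λ (ds : Vec ℤ n) → ∀ x → monic cs x ≡ (x - r) ℤ.* monic ds x + monic cs r
monic-factor (c ∷ []) r = [] , λ x → regroup c x r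
  where regroup : ∀ c x r → c + x ℤ.* + 1 ≡ (x - r) ℤ.* + 1 + (c + r ℤ.* + 1)
        regroup = solve-∀
monic-factor (c ∷ cs@(_ ∷ _)) r with monic-factor cs r
... | ds , cs≡ = monic cs r ∷ ds , λ x → trans (cong (λ y → c + x ℤ.* y) (cs≡ x)) (regroup c x r (monic ds x) (monic cs r))
  where
  regroup : ∀ c x r d e → c + x ℤ.* ((x - r) ℤ.* d + e) ≡ (x - r) ℤ.* (e + x ℤ.* d) + (c + r ℤ.* e)
  regroup c x r d e = begin
    c + x ℤ.* ((x - r) ℤ.* d + e)                            ≡⟨ expand c x (x - r) d e ⟩
    (x - r) ℤ.* (x ℤ.* d) + (c + x ℤ.* e)                    ≡⟨ cong (λ z → (x - r) ℤ.* (x ℤ.* d) + (c + z)) (split x r e) ⟩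
    (x - r) ℤ.* (x ℤ.* d) + (c + ((x - r) ℤ.* e + r ℤ.* e))  ≡⟨ collect (x - r) (x ℤ.* d) c e (r ℤ.* e) ⟩
    (x - r) ℤ.* (e + x ℤ.* d) + (c + r ℤ.* e)                ∎
    where
    open ≡-Reasoning
    expand : ∀ c x y d e → c + x ℤ.* (y ℤ.* d + e) ≡ y ℤ.* (x ℤ.* d) + (c + x ℤ.* e)
    expand = solve-∀
    split : ∀ x r e → x ℤ.* e ≡ (x - r) ℤ.* e + r ℤ.* e
    split = solve-∀
    collect : ∀ y p c e q → y ℤ.* p + (c + (y ℤ.* e + q)) ≡ y ℤ.* (e + p) + (c + q)
    collect = solve-∀

monic-roots-bound : ∀ {p} → Prime p → ∀ n (cs : Vec ℤ n) (roots : Fin (suc n) → ℤ) →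
                    (∀ i j → roots i ≡ roots j mod p → i ≡ j) → ¬ (∀ i → monic cs (roots i) ≡ + 0 mod p)
monic-roots-bound p-prime zero    []  roots distinct vanish = 1≢0-mod p-prime (vanish zero)
monic-roots-bound {p} p-prime (suc n) cs roots distinct vanish with monic-factor cs (roots zero)
... | ds , cs≡ = monic-roots-bound p-prime n ds (roots ∘ suc) (λ i j → Fin.suc-injective ∘ distinct (suc i) (suc j)) ds-vanish
  where
  r = roots zero
  factor-vanishes : ∀ i → (roots (suc i) - r) ℤ.* monic ds (roots (suc i)) ≡ + 0 mod p
  factor-vanishes i = begin
    (x - r) ℤ.* monic ds x                               ≡⟨ cancel ((x - r) ℤ.* monic ds x) (monic cs r) ⟨
    (x - r) ℤ.* monic ds x + monic cs r - monic cs r     ≡⟨ cong (_- monic cs r) (cs≡ x) ⟨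
    monic cs x - monic cs r                              ≈⟨ +-cong-mod (vanish (suc i)) (-‿cong-mod (vanish zero)) ⟩
    + 0                                                  ∎
    where
    open ≡-mod-Reasoning p
    x = roots (suc i)
    cancel : ∀ y c → y + c - c ≡ y
    cancel = solve-∀
  ds-vanish : ∀ i → monic ds (roots (suc i)) ≡ + 0 mod p
  ds-vanish i with euclid-mod p-prime (factor-vanishes i)
  ... | inj₁ x-r≡0 = contradiction (distinct (suc i) zero (mod∣ (≡0-mod⇒∣ x-r≡0))) λ ()
  ... | inj₂ ds≡0  = ds≡0

x^n-1 : ∀ n .{{_ : NonZero n}} → Vec ℤ n
x^n-1 (suc n) = - + 1 ∷ replicate n (+ 0)

monic-x^n-1 : ∀ n .{{_ : NonZero n}} x → monic (x^n-1 n) x ≡ x ^ n - + 1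
monic-x^n-1 (suc n) x = trans (cong (λ y → - + 1 + x ℤ.* y) (monic-0s n)) (ℤ.+-comm (- + 1) (x ^ suc n))
  where monic-0s : ∀ n → monic (replicate n (+ 0)) x ≡ x ^ n
        monic-0s zero    = refl
        monic-0s (suc n) = trans (ℤ.+-identityˡ _) (cong (x ℤ.*_) (monic-0s n))

module _ {p : ℕ} .{{_ : NonZero p}} {a : ℕ} where

  legendre≡1⇒residue : legendre a p ≡ + 1 → ¬ p ∣ a × ∃ λ x → + a ≡ + (x ℕ.* x) mod p
  legendre≡1⇒residue eq with p ∣? a
  ... | yes _ = contradiction eq λ ()
  ... | no p∤a with any? (λ x → x ℕ.* x % p ℕ.≟ a % p) (upTo p)
  ...   | no _    = contradiction eq λ ()
  ...   | yes sq with find sq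
  ...     | x , _ , x²≡a = p∤a , x , %≡%⇒≡-mod (sym x²≡a)

  legendre≡-1⇒nonresidue : legendre a p ≡ - + 1 → ¬ p ∣ a × ∀ {x} → x < p → ¬ + a ≡ + (x ℕ.* x) mod p
  legendre≡-1⇒nonresidue eq with p ∣? a
  ... | yes _ = contradiction eq λ ()
  ... | no p∤a with any? (λ x → x ℕ.* x % p ℕ.≟ a % p) (upTo p)
  ...   | yes _    = contradiction eq λ ()
  ...   | no no-sq = p∤a , λ x<p a≡x² → no-sq (lose (∈-upTo⁺ x<p) (sym (≡-mod⇒%≡% a≡x²)))

module Euler {p h : ℕ} (p-prime : Prime p) (p≡2h+1 : p ≡ suc (h ℕ.+ h)) where

  open Gauss {h = h} p-prime p≡2h+1

  square^h≡1 : ∀ {x} → ¬ p ∣ x → (+ (x ℕ.* x)) ^ h ≡ + 1 mod p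
  square^h≡1 {x} p∤x = begin
    (+ (x ℕ.* x)) ^ h                                    ≡⟨ cong (_^ h) (ℤ.pos-* x x) ⟩
    (+ x ℤ.* + x) ^ h                                    ≡⟨ ^-distribʳ-* (+ x) (+ x) h ⟩
    (+ x) ^ h ℤ.* (+ x) ^ h                              ≈⟨ *-cong-mod (gauss-lemma p∤x) (gauss-lemma p∤x) ⟩
    sgn (gaussParity p h x) ℤ.* sgn (gaussParity p h x)  ≡⟨ sgn-square (gaussParity p h x) ⟩
    + 1                                                  ∎
    where open ≡-mod-Reasoning p

  euler-residue : ∀ {a} → legendre a p ≡ + 1 → gaussParity p h a ≡ 0ℙ
  euler-residue {a} eq with legendre≡1⇒residue {p} {a = a} eq
  ... | p∤a , x , a≡x² = sgn-injective-mod 2<p (begin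
    sgn (gaussParity p h a)  ≈⟨ gauss-lemma p∤a ⟨
    (+ a) ^ h                ≈⟨ ^-cong-mod h a≡x² ⟩
    (+ (x ℕ.* x)) ^ h        ≈⟨ square^h≡1 p∤x ⟩
    + 1                      ∎)
    where
    open ≡-mod-Reasoning p
    p∤x : ¬ p ∣ x
    p∤x p∣x = p∤a (≡0-mod⇒ℕ∣ (≡-mod-trans a≡x² (≡-mod-trans (≡⇒≡-mod (ℤ.pos-* x x))
                (*-cong-mod (ℕ∣⇒≡0-mod p∣x) ≡-mod-refl))))

  squares-distinct : ∀ k l → + (pos k ℕ.* pos k) ≡ + (pos l ℕ.* pos l) mod p → k ≡ l
  squares-distinct k l k²≡l² = ±-case (square-≡-mod p-prime {+ pos k} {+ pos l}
    (subst₂ (_≡_mod p) (ℤ.pos-* (pos k) (pos k)) (ℤ.pos-* (pos l) (pos l)) k²≡l²))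
    where
    ±-case : + pos k ≡ + pos l mod p ⊎ + pos k ≡ - + pos l mod p → k ≡ l
    ±-case (inj₁ k≡l)  = half-system-distinct 0ℙ (≡-mod-trans k≡l (≡⇒≡-mod (sym (ℤ.*-identityˡ (+ pos l)))))
    ±-case (inj₂ k≡-l) = half-system-distinct 1ℙ (≡-mod-trans k≡-l (≡⇒≡-mod (sym (ℤ.-1*i≡-i (+ pos l)))))

  -- x^h − 1 already has the h roots 1², …, h², which are distinct modulo p.
  nonresidue^h≢1 : ∀ {a} → (∀ {x} → x < p → ¬ + a ≡ + (x ℕ.* x) mod p) → ¬ (+ a) ^ h ≡ + 1 mod p
  nonresidue^h≢1 {a} nonresidue a^h≡1 = monic-roots-bound p-prime h (x^n-1 h) roots roots-distinct roots-vanish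
    where
    instance
      h-nonZero : NonZero h
      h-nonZero = ℕ.>-nonZero 1≤h
    roots : Fin (suc h) → ℤ
    roots zero    = + a
    roots (suc k) = + (pos k ℕ.* pos k)
    roots^h≡1 : ∀ i → roots i ^ h ≡ + 1 mod p
    roots^h≡1 zero    = a^h≡1
    roots^h≡1 (suc k) = square^h≡1 (pos≢0-mod k ∘ ℕ∣⇒≡0-mod)
    roots-vanish : ∀ i → monic (x^n-1 h) (roots i) ≡ + 0 mod p
    roots-vanish i = ≡-mod-trans (≡⇒≡-mod (monic-x^n-1 h (roots i))) (+-cong-mod (roots^h≡1 i) ≡-mod-refl)
    roots-distinct : ∀ i j → roots i ≡ roots j mod p → i ≡ j
    roots-distinct zero    zero    _     = refl
    roots-distinct zero    (suc l) a≡l²  = contradiction a≡l² (nonresidue (pos<p l))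
    roots-distinct (suc k) zero    k²≡a  = contradiction (≡-mod-sym k²≡a) (nonresidue (pos<p k))
    roots-distinct (suc k) (suc l) k²≡l² = cong suc (squares-distinct k l k²≡l²)

  euler-nonresidue : ∀ {a} → legendre a p ≡ - + 1 → gaussParity p h a ≡ 1ℙ
  euler-nonresidue {a} eq with legendre≡-1⇒nonresidue {p} {a = a} eq
  ... | p∤a , nonresidue = odd (gaussParity p h a) (gauss-lemma p∤a)
    where
    odd : ∀ μ → (+ a) ^ h ≡ sgn μ mod p → μ ≡ 1ℙ
    odd 1ℙ _     = refl
    odd 0ℙ a^h≡1 = contradiction a^h≡1 (nonresidue^h≢1 nonresidue)

-- Products over sets of distinct primes

coprime-∣-square : ∀ {a b} → Coprime a b → Coprime a (b ℕ.* b)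
coprime-∣-square {a} {b} a⊥b (d∣a , d∣b²) = a⊥b (d∣a , coprime-divisor d⊥b d∣b²)
  where d⊥b : Coprime _ b
        d⊥b (e∣d , e∣b) = a⊥b (ℕ∣.∣-trans e∣d d∣a , e∣b)

coprime-∣-∣⇒*-∣ : ∀ {a b n} → Coprime a b → a ∣ n → b ∣ n → a ℕ.* b ∣ n
coprime-∣-∣⇒*-∣ {a} {b} a⊥b a∣n (divides q n≡qb) with coprime-divisor a⊥b (subst (a ∣_) (trans n≡qb (ℕ.*-comm q b)) a∣n)
... | divides r q≡ra = divides r (trans n≡qb (trans (cong (ℕ._* b) q≡ra) (ℕ.*-assoc r a b)))

-- With g = gcd a c, a = a₁ g and c = c₁ g give a₁ b = g c₁²; hence a₁ ∣ g, and g ∣ a₁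
-- as g is coprime to b.
coprime-square : ∀ {a b c} → Coprime a b → a ℕ.* b ≡ c ℕ.* c → ∃ λ g → a ≡ g ℕ.* g
coprime-square {zero}      _   _     = 0 , refl
coprime-square {a@(suc _)} {b} {c} a⊥b ab≡c² with gcd[m,n]∣m a c | gcd[m,n]∣n a c
... | divides a₁ a≡a₁g | divides c₁ c≡c₁g = g , trans a≡a₁g (cong (ℕ._* g) a₁≡g)
  where
  g = gcd a c
  instance
    g-nonZero : NonZero g
    g-nonZero = ℕ.≢-nonZero λ g≡0 → ℕ.1+n≢0 (gcd[m,n]≡0⇒m≡0 {a} {c} g≡0)
  a₁⊥c₁ : Coprime a₁ c₁
  a₁⊥c₁ = subst₂ Coprime (trans (cong (_/ g) a≡a₁g) (m*n/n≡m a₁ g)) (trans (cong (_/ g) c≡c₁g) (m*n/n≡m c₁ g))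
                 (coprime-/gcd a c)
  a₁b≡gc₁² : a₁ ℕ.* b ≡ g ℕ.* (c₁ ℕ.* c₁)
  a₁b≡gc₁² = ℕ.*-cancelˡ-≡ _ _ g (begin
    g ℕ.* (a₁ ℕ.* b)           ≡⟨ regroup₁ g a₁ b ⟩
    a₁ ℕ.* g ℕ.* b             ≡⟨ cong (ℕ._* b) a≡a₁g ⟨
    a ℕ.* b                    ≡⟨ ab≡c² ⟩
    c ℕ.* c                    ≡⟨ cong₂ ℕ._*_ c≡c₁g c≡c₁g ⟩
    c₁ ℕ.* g ℕ.* (c₁ ℕ.* g)    ≡⟨ regroup₂ c₁ g ⟩
    g ℕ.* (g ℕ.* (c₁ ℕ.* c₁))  ∎)
    where
    open ≡-Reasoning
    regroup₁ : ∀ g a b → g ℕ.* (a ℕ.* b) ≡ a ℕ.* g ℕ.* b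
    regroup₁ = ℕ-Solver.solve-∀
    regroup₂ : ∀ c g → c ℕ.* g ℕ.* (c ℕ.* g) ≡ g ℕ.* (g ℕ.* (c ℕ.* c))
    regroup₂ = ℕ-Solver.solve-∀
  g⊥b : Coprime g b
  g⊥b (d∣g , d∣b) = a⊥b (ℕ∣.∣-trans d∣g (gcd[m,n]∣m a c) , d∣b)
  a₁≡g : a₁ ≡ g
  a₁≡g = ℕ∣.∣-antisym
    (coprime-divisor (coprime-∣-square a₁⊥c₁)
      (divides b (trans (ℕ.*-comm (c₁ ℕ.* c₁) g) (trans (sym a₁b≡gc₁²) (ℕ.*-comm a₁ b)))))
    (coprime-divisor g⊥b (divides (c₁ ℕ.* c₁) (trans (ℕ.*-comm b a₁) (trans a₁b≡gc₁² (ℕ.*-comm g _)))))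

consecutive-coprime : ∀ {a b k} → a ∣ suc k → b ∣ k → Coprime a b
consecutive-coprime {k = k} a∣k+1 b∣k {i} (i∣a , i∣b) =
  ℕ∣.∣1⇒≡1 (ℕ∣.∣m+n∣m⇒∣n (subst (i ∣_) (ℕ.+-comm 1 k) (ℕ∣.∣-trans i∣a a∣k+1)) (ℕ∣.∣-trans i∣b b∣k))

prime∤⇒coprime : ∀ {p n} → Prime p → ¬ p ∣ n → Coprime p n
prime∤⇒coprime p-prime p∤n (d∣p , d∣n) with prime⇒irreducible p-prime d∣p
... | inj₁ d≡1  = d≡1
... | inj₂ refl = contradiction d∣n p∤n

prodFin≡∏ℕ : ∀ n f → prodFin n f ≡ ∏ℕ f
prodFin≡∏ℕ zero    f = refl
prodFin≡∏ℕ (suc n) f = cong (f zero ℕ.*_) (begin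
  product (map f (tabulate suc))      ≡⟨ cong product (map-tabulate suc f) ⟩
  product (tabulate (f ∘ suc))        ≡⟨ cong product (map-tabulate id (f ∘ suc)) ⟨
  product (map (f ∘ suc) (allFin n))  ≡⟨ prodFin≡∏ℕ n (f ∘ suc) ⟩
  ∏ℕ (f ∘ suc)                        ∎)
  where open ≡-Reasoning

∏ℕ-nonZero : ∀ {n} (f : Fin n → ℕ) → (∀ i → NonZero (f i)) → NonZero (∏ℕ f)
∏ℕ-nonZero {zero}  f _       = _
∏ℕ-nonZero {suc n} f nonZero =
  ℕ.m*n≢0 (f zero) (∏ℕ (f ∘ suc)) {{nonZero zero}} {{∏ℕ-nonZero (f ∘ suc) (nonZero ∘ suc)}}

∣-∏ℕ : ∀ {n} (f : Fin n → ℕ) i → f i ∣ ∏ℕ f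
∣-∏ℕ f zero    = ℕ∣.m∣m*n _
∣-∏ℕ f (suc i) = ℕ∣.∣-trans (∣-∏ℕ (f ∘ suc) i) (ℕ∣.n∣m*n (f zero))

select : Parity → ℕ → ℕ
select 0ℙ _ = 1
select 1ℙ a = a

∏⟨_⟩ : ∀ {n} → (Fin n → Parity) → (Fin n → ℕ) → ℕ
∏⟨ x ⟩ f = ∏ℕ λ i → select (x i) (f i)

∁ : ∀ {n} → (Fin n → Parity) → Fin n → Parity
∁ x i = x i ℙ.+ 1ℙ

∏⟨⟩-split : ∀ {n} (x : Fin n → Parity) f → ∏⟨ x ⟩ f ℕ.* ∏⟨ ∁ x ⟩ f ≡ ∏ℕ f
∏⟨⟩-split {n} x f =
  trans (sym (∏ℕ-distrib-* (λ i → select (x i) (f i)) (λ i → select (∁ x i) (f i))))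
        (∏ℕ-cong {n} (λ i → select-split (x i) (f i)))
  where select-split : ∀ y a → select y a ℕ.* select (y ℙ.+ 1ℙ) a ≡ a
        select-split 0ℙ a = ℕ.*-identityˡ a
        select-split 1ℙ a = ℕ.*-identityʳ a

∏⟨0⟩≡1 : ∀ {n} (x : Fin n → Parity) f → (∀ i → x i ≡ 0ℙ) → ∏⟨ x ⟩ f ≡ 1
∏⟨0⟩≡1 {n} x f x≡0 = trans (∏ℕ-cong {n} (λ i → cong (λ y → select y (f i)) (x≡0 i))) (∏ℕ-ones n)

∏⟨∁0⟩≡∏ : ∀ {n} (x : Fin n → Parity) f → (∀ i → x i ≡ 0ℙ) → ∏⟨ ∁ x ⟩ f ≡ ∏ℕ f
∏⟨∁0⟩≡∏ {n} x f x≡0 = ∏ℕ-cong {n} (λ i → cong (λ y → select (y ℙ.+ 1ℙ) (f i)) (x≡0 i))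

select-∣-∏⟨⟩ : ∀ {n} (x : Fin n → Parity) f {i} → x i ≡ 1ℙ → f i ∣ ∏⟨ x ⟩ f
select-∣-∏⟨⟩ x f {i} xᵢ≡1 =
  subst (_∣ ∏⟨ x ⟩ f) (cong (λ y → select y (f i)) xᵢ≡1) (∣-∏ℕ (λ i → select (x i) (f i)) i)

prime∤select : ∀ {p a} → Prime p → ∀ y → (y ≡ 1ℙ → ¬ p ∣ a) → ¬ p ∣ select y a
prime∤select p-prime 0ℙ _   p∣1 = ℕ.nonTrivial⇒≢1 {{prime⇒nonTrivial p-prime}} (ℕ∣.∣1⇒≡1 p∣1)
prime∤select p-prime 1ℙ p∤a     = p∤a refl

prime∤∏⟨⟩ : ∀ {n p} (ℓ : Fin n → ℕ) x → Prime p → (∀ i → x i ≡ 1ℙ → ¬ p ∣ ℓ i) → ¬ p ∣ ∏⟨ x ⟩ ℓ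
prime∤∏⟨⟩ {zero}  ℓ x p-prime _   = prime∤select {a = 1} p-prime 0ℙ λ ()
prime∤∏⟨⟩ {suc n} ℓ x p-prime p∤ℓ p∣∏
  with euclidsLemma (select (x zero) (ℓ zero)) (∏⟨ x ∘ suc ⟩ (ℓ ∘ suc)) p-prime p∣∏
... | inj₁ p∣head = prime∤select p-prime (x zero) (p∤ℓ zero) p∣head
... | inj₂ p∣rest = prime∤∏⟨⟩ (ℓ ∘ suc) (x ∘ suc) p-prime (p∤ℓ ∘ suc) p∣rest

∏⟨⟩-∣ : ∀ {n N} (ℓ : Fin n → ℕ) x → (∀ i → Prime (ℓ i)) → Injective _≡_ _≡_ ℓ →
        (∀ i → x i ≡ 1ℙ → ℓ i ∣ N) → ∏⟨ x ⟩ ℓ ∣ N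
∏⟨⟩-∣ {zero}  {N} _ _ _     _   _  = ℕ∣.1∣ N
∏⟨⟩-∣ {suc n} {N} ℓ x prime inj ∣N = combine (x zero) (∣N zero)
  where
  rest : ∏⟨ x ∘ suc ⟩ (ℓ ∘ suc) ∣ N
  rest = ∏⟨⟩-∣ (ℓ ∘ suc) (x ∘ suc) (prime ∘ suc) (Fin.suc-injective ∘ inj) (∣N ∘ suc)
  ℓ₀⊥rest : Coprime (ℓ zero) (∏⟨ x ∘ suc ⟩ (ℓ ∘ suc))
  ℓ₀⊥rest = prime∤⇒coprime (prime zero) (prime∤∏⟨⟩ (ℓ ∘ suc) (x ∘ suc) (prime zero)
              (λ i _ → prime∤prime (prime zero) (prime (suc i)) (Fin.0≢1+n ∘ inj)))
  combine : ∀ y → (y ≡ 1ℙ → ℓ zero ∣ N) → select y (ℓ zero) ℕ.* ∏⟨ x ∘ suc ⟩ (ℓ ∘ suc) ∣ N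
  combine 0ℙ _    = subst (_∣ N) (sym (ℕ.*-identityˡ _)) rest
  combine 1ℙ ℓ₀∣N = coprime-∣-∣⇒*-∣ ℓ₀⊥rest (ℓ₀∣N refl) rest

-- e collects the ℓᵢ dividing k + 1 and d the others; as k and k + 1 are coprime,
-- (k + 1) / e and k / d are coprime with product c², hence squares.
module _ {n} (ℓ : Fin n → ℕ) (ℓ-prime : ∀ i → Prime (ℓ i)) (ℓ-injective : Injective _≡_ _≡_ ℓ)
         {k c : ℕ} (k[k+1]≡mc² : k ℕ.* suc k ≡ ∏ℕ ℓ ℕ.* (c ℕ.* c)) where

  private
    x : Fin n → Parity
    x i with ℓ i ∣? suc k
    ... | yes _ = 1ℙ
    ... | no  _ = 0ℙ

    x≡1⇒∣k+1 : ∀ i → x i ≡ 1ℙ → ℓ i ∣ suc k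
    x≡1⇒∣k+1 i with ℓ i ∣? suc k
    ... | yes ℓᵢ∣k+1 = λ _ → ℓᵢ∣k+1
    ... | no  _      = λ ()

    ∁x≡1⇒∣k : ∀ i → ∁ x i ≡ 1ℙ → ℓ i ∣ k
    ∁x≡1⇒∣k i with ℓ i ∣? suc k
    ... | yes _      = λ ()
    ... | no  ℓᵢ∤k+1 = λ _ → ℓᵢ∣k
      where
      ℓᵢ∣k : ℓ i ∣ k
      ℓᵢ∣k with euclidsLemma k (suc k) (ℓ-prime i)
                  (subst (ℓ i ∣_) (sym k[k+1]≡mc²) (ℕ∣.∣-trans (∣-∏ℕ ℓ i) (ℕ∣.m∣m*n (c ℕ.* c))))
      ... | inj₁ ℓᵢ∣k   = ℓᵢ∣k
      ... | inj₂ ℓᵢ∣k+1 = contradiction ℓᵢ∣k+1 ℓᵢ∤k+1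

    e d : ℕ
    e = ∏⟨ x ⟩ ℓ
    d = ∏⟨ ∁ x ⟩ ℓ

    e∣k+1 : e ∣ suc k
    e∣k+1 = ∏⟨⟩-∣ ℓ x ℓ-prime ℓ-injective x≡1⇒∣k+1

    d∣k : d ∣ k
    d∣k = ∏⟨⟩-∣ ℓ (∁ x) ℓ-prime ℓ-injective ∁x≡1⇒∣k

    instance
      ed-nonZero : NonZero (e ℕ.* d)
      ed-nonZero = subst NonZero (sym (∏⟨⟩-split x ℓ)) (∏ℕ-nonZero ℓ (prime⇒nonZero ∘ ℓ-prime))

    open ℕ∣._∣_ e∣k+1 using () renaming (quotient to a; equality to k+1≡ae)
    open ℕ∣._∣_ d∣k using () renaming (quotient to b; equality to k≡bd)

    ab≡c² : a ℕ.* b ≡ c ℕ.* c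
    ab≡c² = ℕ.*-cancelˡ-≡ _ _ (e ℕ.* d) (begin
      e ℕ.* d ℕ.* (a ℕ.* b)  ≡⟨ regroup e d a b ⟩
      a ℕ.* e ℕ.* (b ℕ.* d)  ≡⟨ cong₂ ℕ._*_ k+1≡ae k≡bd ⟨
      suc k ℕ.* k            ≡⟨ ℕ.*-comm (suc k) k ⟩
      k ℕ.* suc k            ≡⟨ k[k+1]≡mc² ⟩
      ∏ℕ ℓ ℕ.* (c ℕ.* c)     ≡⟨ cong (ℕ._* (c ℕ.* c)) (∏⟨⟩-split x ℓ) ⟨
      e ℕ.* d ℕ.* (c ℕ.* c)  ∎)
      where
      open ≡-Reasoning
      regroup : ∀ e d a b → e ℕ.* d ℕ.* (a ℕ.* b) ≡ a ℕ.* e ℕ.* (b ℕ.* d)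
      regroup = ℕ-Solver.solve-∀

    a⊥b : Coprime a b
    a⊥b = consecutive-coprime (divides e (trans k+1≡ae (ℕ.*-comm a e))) (divides d (trans k≡bd (ℕ.*-comm b d)))

  consecutive-split : ∃ λ x → ∃₂ λ g t → suc k ≡ ∏⟨ x ⟩ ℓ ℕ.* (g ℕ.* g) × k ≡ ∏⟨ ∁ x ⟩ ℓ ℕ.* (t ℕ.* t)
  consecutive-split
    with coprime-square {c = c} a⊥b ab≡c² | coprime-square {c = c} (Coprime.sym a⊥b) (trans (ℕ.*-comm b a) ab≡c²)
  ... | g , a≡g² | t , b≡t² =
    x , g , t , trans k+1≡ae (trans (cong (ℕ._* e) a≡g²) (ℕ.*-comm _ e)) , trans k≡bd (trans (cong (ℕ._* d) b≡t²) (ℕ.*-comm _ d))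

module _ {p h : ℕ} (p-prime : Prime p) (p≡2h+1 : p ≡ suc (h ℕ.+ h)) where

  open Gauss {h = h} p-prime p≡2h+1
  open Euler {h = h} p-prime p≡2h+1

  ∏⟨⟩^h : ∀ {n} (ℓ : Fin n → ℕ) x → (∀ i → x i ≡ 1ℙ → ¬ p ∣ ℓ i) →
          (+ ∏⟨ x ⟩ ℓ) ^ h ≡ sgn (∑ℙ λ i → x i ℙ.* gaussParity p h (ℓ i)) mod p
  ∏⟨⟩^h ℓ x p∤ℓ = begin
    (+ ∏⟨ x ⟩ ℓ) ^ h                               ≡⟨ cong (_^ h) (foldr-homo +_ refl ℤ.pos-* (λ i → select (x i) (ℓ i))) ⟩
    ∏ (λ i → + select (x i) (ℓ i)) ^ h             ≡⟨ ∏-^ (λ i → + select (x i) (ℓ i)) h ⟩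
    ∏ (λ i → (+ select (x i) (ℓ i)) ^ h)           ≈⟨ ∏-cong-mod (λ i → select^h (x i) (p∤ℓ i)) ⟩
    ∏ (λ i → sgn (x i ℙ.* gaussParity p h (ℓ i)))  ≡⟨ ∏-sgn (λ i → x i ℙ.* gaussParity p h (ℓ i)) ⟩
    sgn (∑ℙ λ i → x i ℙ.* gaussParity p h (ℓ i))   ∎
    where
    open ≡-mod-Reasoning p
    select^h : ∀ y {a} → (y ≡ 1ℙ → ¬ p ∣ a) → (+ select y a) ^ h ≡ sgn (y ℙ.* gaussParity p h a) mod p
    select^h 0ℙ _   = ≡⇒≡-mod (ℤ.^-zeroˡ h)
    select^h 1ℙ p∤a = gauss-lemma (p∤a refl)

  ^h-cancel-square : ∀ {e g w} → + (e ℕ.* (g ℕ.* g)) ≡ w mod p → ¬ w ≡ + 0 mod p → (+ e) ^ h ≡ w ^ h mod p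
  ^h-cancel-square {e} {g} {w} eg²≡w w≢0 = begin
    (+ e) ^ h                        ≡⟨ ℤ.*-identityʳ _ ⟨
    (+ e) ^ h ℤ.* + 1                ≈⟨ *-cong-mod (≡-mod-refl {x = (+ e) ^ h}) (square^h≡1 p∤g) ⟨
    (+ e) ^ h ℤ.* (+ (g ℕ.* g)) ^ h  ≡⟨ ^-distribʳ-* (+ e) (+ (g ℕ.* g)) h ⟨
    (+ e ℤ.* + (g ℕ.* g)) ^ h        ≡⟨ cong (_^ h) (ℤ.pos-* e (g ℕ.* g)) ⟨
    (+ (e ℕ.* (g ℕ.* g))) ^ h        ≈⟨ ^-cong-mod h eg²≡w ⟩
    w ^ h                            ∎
    where
    open ≡-mod-Reasoning p
    p∤g : ¬ p ∣ g
    p∤g p∣g = w≢0 (≡-mod-trans (≡-mod-sym eg²≡w)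
                (ℕ∣⇒≡0-mod (ℕ∣.∣-trans p∣g (ℕ∣.∣-trans (ℕ∣.m∣m*n g) (ℕ∣.n∣m*n e)))))

  subset-character : ∀ {n} (ℓ : Fin n → ℕ) x {g w} → (∀ i → x i ≡ 1ℙ → ¬ p ∣ ℓ i) →
                     + (∏⟨ x ⟩ ℓ ℕ.* (g ℕ.* g)) ≡ w mod p → ¬ w ≡ + 0 mod p →
                     sgn (∑ℙ λ i → x i ℙ.* gaussParity p h (ℓ i)) ≡ w ^ h mod p
  subset-character ℓ x {g} p∤ℓ eg²≡w w≢0 =
    ≡-mod-trans (≡-mod-sym (∏⟨⟩^h ℓ x p∤ℓ)) (^h-cancel-square {∏⟨ x ⟩ ℓ} {g} eg²≡w w≢0)

-- Units of ℤ[√m] with even second coordinate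

remainder-quotient-injective : ∀ d .{{_ : NonZero d}} {r s} x y → r < d → s < d →
                               r ℕ.+ x ℕ.* d ≡ s ℕ.+ y ℕ.* d → r ≡ s × x ≡ y
remainder-quotient-injective d {r} {s} x y r<d s<d eq =
  r≡s , ℕ.*-cancelʳ-≡ x y d (ℕ.+-cancelˡ-≡ r _ _ (trans eq (cong (ℕ._+ y ℕ.* d) (sym r≡s))))
  where
  open ≡-Reasoning
  r≡s : r ≡ s
  r≡s = begin
    r                    ≡⟨ m<n⇒m%n≡m r<d ⟨
    r % d                ≡⟨ [m+kn]%n≡m%n r x d ⟨
    (r ℕ.+ x ℕ.* d) % d  ≡⟨ cong (_% d) eq ⟩
    (s ℕ.+ y ℕ.* d) % d  ≡⟨ [m+kn]%n≡m%n s y d ⟩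
    s % d                ≡⟨ m<n⇒m%n≡m s<d ⟩
    s                    ∎

even-or-odd : ∀ n → n ≡ n / 2 ℕ.* 2 ⊎ n ≡ 1 ℕ.+ n / 2 ℕ.* 2
even-or-odd n with n % 2 | m%n<n n 2 | m≡m%n+[m/n]*n n 2
... | 0           | _            | n≡ = inj₁ n≡
... | 1           | _            | n≡ = inj₂ n≡
... | suc (suc _) | s≤s (s≤s ()) | _

∤2⇒%2≡1 : ∀ n → ¬ 2 ∣ n → n % 2 ≡ 1
∤2⇒%2≡1 n 2∤n with n % 2 in n%2≡r | m%n<n n 2
... | 0           | _            = contradiction (ℕ∣.m%n≡0⇒n∣m n 2 n%2≡r) 2∤n
... | 1           | _            = refl
... | suc (suc _) | s≤s (s≤s ())

square-mod-4 : ∀ n → let u = n / 2 in n ℕ.* n ≡ 0 ℕ.+ (u ℕ.* u) ℕ.* 4 ⊎ n ℕ.* n ≡ 1 ℕ.+ (u ℕ.* suc u) ℕ.* 4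
square-mod-4 n with even-or-odd n
... | inj₁ n≡2u   = inj₁ (trans (cong (λ z → z ℕ.* z) n≡2u) (even² (n / 2)))
  where even² : ∀ u → u ℕ.* 2 ℕ.* (u ℕ.* 2) ≡ (u ℕ.* u) ℕ.* 4
        even² = ℕ-Solver.solve-∀
... | inj₂ n≡2u+1 = inj₂ (trans (cong (λ z → z ℕ.* z) n≡2u+1) (odd² (n / 2)))
  where odd² : ∀ u → (1 ℕ.+ u ℕ.* 2) ℕ.* (1 ℕ.+ u ℕ.* 2) ≡ 1 ℕ.+ (u ℕ.* suc u) ℕ.* 4
        odd² = ℕ-Solver.solve-∀

norm-pos : ∀ m x y → + x ℤ.* + x - + m ℤ.* + y ℤ.* + y ≡ + (x ℕ.* x) - + (m ℕ.* (y ℕ.* y))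
norm-pos m x y = cong₂ _-_ (sym (ℤ.pos-* x x)) (begin
  + m ℤ.* + y ℤ.* + y  ≡⟨ cong (ℤ._* + y) (ℤ.pos-* m y) ⟨
  + (m ℕ.* y) ℤ.* + y  ≡⟨ ℤ.pos-* (m ℕ.* y) y ⟨
  + (m ℕ.* y ℕ.* y)    ≡⟨ cong +_ (ℕ.*-assoc m y y) ⟩
  + (m ℕ.* (y ℕ.* y))  ∎)
  where open ≡-Reasoning

pos-diff≡1⇒≡suc : ∀ {x y} → + x - + y ≡ + 1 → x ≡ suc y
pos-diff≡1⇒≡suc {x} {y} eq = ℤ.+-injective (trans (split (+ x) (+ y)) (trans (cong (_+ + y) eq) (sym (ℤ.pos-+ 1 y))))
  where split : ∀ x y → x ≡ (x - y) + y
        split = solve-∀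

pos-diff≡-1⇒suc≡ : ∀ {x y} → + x - + y ≡ - + 1 → suc x ≡ y
pos-diff≡-1⇒suc≡ {x} {y} eq = ℤ.+-injective (trans (ℤ.pos-+ 1 x) (trans (split (+ x) (+ y)) (cong (λ z → + 1 + z + + y) eq)))
  where split : ∀ x y → + 1 + x ≡ + 1 + (x - y) + y
        split = solve-∀

unit⇒pell : ∀ {m x y} → IsUnit m (+ x) (+ y) → x ℕ.* x ≡ suc (m ℕ.* (y ℕ.* y)) ⊎ suc (x ℕ.* x) ≡ m ℕ.* (y ℕ.* y)
unit⇒pell {m} {x} {y} (inj₁ N≡1)  = inj₁ (pos-diff≡1⇒≡suc (trans (sym (norm-pos m x y)) N≡1))
unit⇒pell {m} {x} {y} (inj₂ N≡-1) = inj₂ (pos-diff≡-1⇒suc≡ (trans (sym (norm-pos m x y)) N≡-1))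

pell⇒unit : ∀ {m g t} → g ℕ.* g ≡ suc (m ℕ.* (t ℕ.* t)) → IsUnit m (+ g) (+ t)
pell⇒unit {m} {g} {t} eq =
  inj₁ (trans (norm-pos m g t) (trans (cong (λ z → + z - + (m ℕ.* (t ℕ.* t))) eq) (cancel (+ (m ℕ.* (t ℕ.* t))))))
  where cancel : ∀ y → + 1 + y - y ≡ + 1
        cancel = solve-∀

-- Modulo 4, the norm equation a² − m (2c)² = ±1 excludes the norm −1 and an even a;
-- for a = 2k + 1 it becomes k (k + 1) = m c².
module _ (m a c : ℕ) where

  private
    u D : ℕ
    u = a / 2
    D = m ℕ.* (c ℕ.* c)

    m[2c]²≡4D : m ℕ.* (c ℕ.* 2 ℕ.* (c ℕ.* 2)) ≡ 0 ℕ.+ D ℕ.* 4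
    m[2c]²≡4D = regroup m c
      where regroup : ∀ m c → m ℕ.* (c ℕ.* 2 ℕ.* (c ℕ.* 2)) ≡ m ℕ.* (c ℕ.* c) ℕ.* 4
            regroup = ℕ-Solver.solve-∀

  even-b-norm : a ℕ.* a ≡ suc (m ℕ.* (c ℕ.* 2 ℕ.* (c ℕ.* 2))) ⊎ suc (a ℕ.* a) ≡ m ℕ.* (c ℕ.* 2 ℕ.* (c ℕ.* 2)) →
                u ℕ.* suc u ≡ D
  even-b-norm norm with norm | square-mod-4 a
  ... | inj₁ a²≡1+mb² | inj₂ a²≡1+4Q = proj₂ (remainder-quotient-injective 4 (u ℕ.* suc u) D (s≤s (s≤s z≤n)) (s≤s (s≤s z≤n))
    (trans (sym a²≡1+4Q) (trans a²≡1+mb² (cong suc m[2c]²≡4D))))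
  ... | inj₁ a²≡1+mb² | inj₁ a²≡0+4Q = contradiction (proj₁ (remainder-quotient-injective 4 (u ℕ.* u) D (s≤s z≤n) (s≤s (s≤s z≤n))
    (trans (sym a²≡0+4Q) (trans a²≡1+mb² (cong suc m[2c]²≡4D))))) λ ()
  ... | inj₂ 1+a²≡mb² | inj₁ a²≡0+4Q = contradiction (proj₁ (remainder-quotient-injective 4 (u ℕ.* u) D (s≤s (s≤s z≤n)) (s≤s z≤n)
    (trans (cong suc (sym a²≡0+4Q)) (trans 1+a²≡mb² m[2c]²≡4D)))) λ ()
  ... | inj₂ 1+a²≡mb² | inj₂ a²≡1+4Q = contradiction (proj₁ (remainder-quotient-injective 4 (u ℕ.* suc u) D (s≤s (s≤s (s≤s z≤n))) (s≤s z≤n)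
    (trans (cong suc (sym a²≡1+4Q)) (trans 1+a²≡mb² m[2c]²≡4D)))) λ ()

fundamental-unit-even-b : ∀ {m a b} → IsFundamentalUnit m a b → 2 ∣ ∣ b ∣ →
  ∃₂ λ k c → k ℕ.* suc k ≡ m ℕ.* (c ℕ.* c) × 1 ≤ c ×
             (∀ g t → g ℕ.* g ≡ suc (m ℕ.* (t ℕ.* t)) → 1 ≤ g → 1 ≤ t → c ℕ.* 2 ≤ t)
fundamental-unit-even-b {a = + zero}  (_ , +<+ () , _)
fundamental-unit-even-b {a = -[1+ _ ]} (_ , () , _)
fundamental-unit-even-b {a = +[1+ _ ]} {+ zero}  (_ , _ , +<+ () , _)
fundamental-unit-even-b {a = +[1+ _ ]} { -[1+ _ ]} (_ , _ , () , _)
fundamental-unit-even-b {m} {+[1+ a ]} {+[1+ b ]} (unit , _ , _ , minimal) (divides c 1+b≡2c) =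
  suc a / 2 , c , even-b-norm m (suc a) c norm , 1≤c , 2c≤t
  where
  norm : suc a ℕ.* suc a ≡ suc (m ℕ.* (c ℕ.* 2 ℕ.* (c ℕ.* 2))) ⊎ suc (suc a ℕ.* suc a) ≡ m ℕ.* (c ℕ.* 2 ℕ.* (c ℕ.* 2))
  norm = subst (λ B → suc a ℕ.* suc a ≡ suc (m ℕ.* (B ℕ.* B)) ⊎ suc (suc a ℕ.* suc a) ≡ m ℕ.* (B ℕ.* B))
               1+b≡2c (unit⇒pell {m} {suc a} {suc b} unit)
  1≤c : 1 ≤ c
  1≤c = ℕ.n≢0⇒n>0 λ c≡0 → ℕ.0≢1+n (sym (trans 1+b≡2c (cong (ℕ._* 2) c≡0)))
  2c≤t : ∀ g t → g ℕ.* g ≡ suc (m ℕ.* (t ℕ.* t)) → 1 ≤ g → 1 ≤ t → c ℕ.* 2 ≤ t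
  2c≤t g t g²≡1+mt² 1≤g 1≤t =
    subst (_≤ t) 1+b≡2c (ℤ.drop‿+≤+ (proj₂ (minimal (+ g) (+ t) (pell⇒unit {m} {g} {t} g²≡1+mt²) (+<+ 1≤g) (+<+ 1≤t))))

square-injective : ∀ {x y} → x ℕ.* x ≡ y ℕ.* y → x ≡ y
square-injective {x} {y} x²≡y² with ℕ.<-cmp x y
... | tri< x<y _ _ = contradiction x²≡y² (ℕ.<⇒≢ (ℕ.*-mono-< x<y x<y))
... | tri≈ _ x≡y _ = x≡y
... | tri> _ _ y<x = contradiction (sym x²≡y²) (ℕ.<⇒≢ (ℕ.*-mono-< y<x y<x))

smaller-solution : ∀ {m k c g t} .{{_ : NonZero m}} → k ℕ.* suc k ≡ m ℕ.* (c ℕ.* c) → 1 ≤ c →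
                   suc k ≡ g ℕ.* g → k ≡ m ℕ.* (t ℕ.* t) →
                   g ℕ.* g ≡ suc (m ℕ.* (t ℕ.* t)) × 1 ≤ g × 1 ≤ t × t < c ℕ.* 2
smaller-solution {m} {k} {c} {g} {t} k[k+1]≡mc² 1≤c k+1≡g² k≡mt² = g²≡1+mt² , 1≤g , 1≤t , t<2c
  where
  open ≡-Reasoning
  g²≡1+mt² : g ℕ.* g ≡ suc (m ℕ.* (t ℕ.* t))
  g²≡1+mt² = trans (sym k+1≡g²) (cong suc k≡mt²)
  tg≡c : t ℕ.* g ≡ c
  tg≡c = square-injective (ℕ.*-cancelˡ-≡ _ _ m (begin
    m ℕ.* (t ℕ.* g ℕ.* (t ℕ.* g))  ≡⟨ regroup m t g ⟩
    m ℕ.* (t ℕ.* t) ℕ.* (g ℕ.* g)  ≡⟨ cong₂ ℕ._*_ k≡mt² k+1≡g² ⟨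
    k ℕ.* suc k                    ≡⟨ k[k+1]≡mc² ⟩
    m ℕ.* (c ℕ.* c)                ∎))
    where regroup : ∀ m t g → m ℕ.* (t ℕ.* g ℕ.* (t ℕ.* g)) ≡ m ℕ.* (t ℕ.* t) ℕ.* (g ℕ.* g)
          regroup = ℕ-Solver.solve-∀
  1≤g : 1 ≤ g
  1≤g = ℕ.n≢0⇒n>0 λ g≡0 → ℕ.1+n≢0 (trans (sym g²≡1+mt²) (cong (λ z → z ℕ.* z) g≡0))
  1≤t : 1 ≤ t
  1≤t = ℕ.n≢0⇒n>0 λ t≡0 → ℕ.<⇒≢ 1≤c (sym (trans (sym tg≡c) (cong (ℕ._* g) t≡0)))
  t<2c : t < c ℕ.* 2
  t<2c = ℕ.≤-<-trans (subst (t ≤_) tg≡c (ℕ.m≤m*n t g {{ℕ.>-nonZero 1≤g}}))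
                     (subst (c <_) (ℕ.*-comm 2 c) (subst (c <_) (cong (c ℕ.+_) (sym (ℕ.+-identityʳ c))) (ℕ.m<m+n c 1≤c)))

-- A linear system over 𝔽₂

δ₀ : ℕ → Parity
δ₀ zero    = 1ℙ
δ₀ (suc _) = 0ℙ

-- nonresidue j i = 1ℙ says that ℓᵢ is a nonresidue modulo ℓⱼ in the pattern of the
-- hypotheses, with the primes indexed from 0; the diagonal value is never used.
nonresidue : ℕ → ℕ → Parity
nonresidue zero          zero          = 0ℙ
nonresidue zero          (suc zero)    = 1ℙ
nonresidue zero          (suc (suc _)) = 0ℙ
nonresidue (suc _)       (suc _)       = 1ℙ
nonresidue (suc zero)    zero          = 1ℙ
nonresidue (suc (suc _)) zero          = 0ℙ

nonresidue-sym : ∀ i j → nonresidue i j ≡ nonresidue j i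
nonresidue-sym zero          zero          = refl
nonresidue-sym zero          (suc zero)    = refl
nonresidue-sym zero          (suc (suc _)) = refl
nonresidue-sym (suc _)       (suc _)       = refl
nonresidue-sym (suc zero)    zero          = refl
nonresidue-sym (suc (suc _)) zero          = refl

∑ℙ-const : ∀ n c → ∑ℙ {n} (λ _ → c) ≡ parity n ℙ.* c
∑ℙ-const zero          c = refl
∑ℙ-const (suc zero)    c = ℙ.+-identityʳ c
∑ℙ-const (suc (suc n)) c = begin
  c ℙ.+ (c ℙ.+ ∑ℙ {n} (λ _ → c))  ≡⟨ ℙ.+-assoc c c _ ⟨
  c ℙ.+ c ℙ.+ ∑ℙ {n} (λ _ → c)    ≡⟨ cong (ℙ._+ ∑ℙ {n} (λ _ → c)) (ℙ.p+p≡0ℙ c) ⟩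
  ∑ℙ {n} (λ _ → c)                ≡⟨ ∑ℙ-const n c ⟩
  parity n ℙ.* c                  ∎
  where open ≡-Reasoning

module _ {n′ : ℕ} (n′-even : parity n′ ≡ 0ℙ) (x : Fin (2 ℕ.+ n′) → Parity) where

  private
    X : Parity
    X = ∑ℙ (λ (i : Fin n′) → x (suc (suc i)))

    ∑-tail-1 : ∀ c → ∑ℙ (λ i → (x (suc (suc i)) ℙ.+ c) ℙ.* 1ℙ) ≡ X
    ∑-tail-1 c = begin
      ∑ℙ (λ i → (x (suc (suc i)) ℙ.+ c) ℙ.* 1ℙ)  ≡⟨ ∑ℙ-cong {n′} (λ i → ℙ.*-identityʳ _) ⟩
      ∑ℙ (λ i → x (suc (suc i)) ℙ.+ c)           ≡⟨ ∑ℙ-distrib-+ (λ i → x (suc (suc i))) (λ _ → c) ⟩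
      X ℙ.+ ∑ℙ {n′} (λ _ → c)                    ≡⟨ cong (X ℙ.+_) (trans (∑ℙ-const n′ c) (cong (ℙ._* c) n′-even)) ⟩
      X ℙ.+ 0ℙ                                   ≡⟨ ℙ.+-identityʳ X ⟩
      X                                          ∎
      where open ≡-Reasoning

    ∑-tail-0 : ∀ (y : Fin n′ → Parity) → ∑ℙ (λ i → y i ℙ.* 0ℙ) ≡ 0ℙ
    ∑-tail-0 y = trans (∑ℙ-cong {n′} (λ i → ℙ.*-zeroʳ (y i))) (trans (∑ℙ-const n′ 0ℙ) (ℙ.*-zeroʳ (parity n′)))

    row₀ : ∀ x₀ x₁ → (x₀ ℙ.+ x₀) ℙ.* 0ℙ ℙ.+ ((x₁ ℙ.+ x₀) ℙ.* 1ℙ ℙ.+ 0ℙ) ≡ x₀ ℙ.* 1ℙ → x₁ ≡ 0ℙ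
    row₀ 0ℙ 0ℙ _ = refl
    row₀ 1ℙ 0ℙ _ = refl
    row₀ 0ℙ 1ℙ ()
    row₀ 1ℙ 1ℙ ()

    row₁ : ∀ x₀ X → (x₀ ℙ.+ 0ℙ) ℙ.* 1ℙ ℙ.+ ((0ℙ ℙ.+ 0ℙ) ℙ.* 1ℙ ℙ.+ X) ≡ 0ℙ ℙ.* 0ℙ → x₀ ≡ X
    row₁ 0ℙ 0ℙ _ = refl
    row₁ 1ℙ 1ℙ _ = refl
    row₁ 0ℙ 1ℙ ()
    row₁ 1ℙ 0ℙ ()

    rowⱼ : ∀ x₀ xⱼ X → (x₀ ℙ.+ xⱼ) ℙ.* 0ℙ ℙ.+ ((0ℙ ℙ.+ xⱼ) ℙ.* 1ℙ ℙ.+ X) ≡ xⱼ ℙ.* 0ℙ → xⱼ ≡ X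
    rowⱼ _  0ℙ 0ℙ _ = refl
    rowⱼ _  1ℙ 1ℙ _ = refl
    rowⱼ 0ℙ 0ℙ 1ℙ ()
    rowⱼ 1ℙ 0ℙ 1ℙ ()
    rowⱼ 0ℙ 1ℙ 0ℙ ()
    rowⱼ 1ℙ 1ℙ 0ℙ ()

  -- With X the sum of the xᵢ for i ≥ 2, row 0 gives x₁ = 0, row 1 gives x₀ = X and
  -- row j ≥ 2 gives xⱼ = X; summing the latter, X = n′ X = 0.
  only-trivial-split : (∀ j → ∑ℙ (λ i → (x i ℙ.+ x j) ℙ.* nonresidue (toℕ j) (toℕ i)) ≡ x j ℙ.* δ₀ (toℕ j)) →
                       ∀ j → x j ≡ 0ℙ
  only-trivial-split equation = x≡0
    where
    x₁≡0 : x (suc zero) ≡ 0ℙ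
    x₁≡0 = row₀ (x zero) (x (suc zero))
      (subst (λ S → (x zero ℙ.+ x zero) ℙ.* 0ℙ ℙ.+ ((x (suc zero) ℙ.+ x zero) ℙ.* 1ℙ ℙ.+ S) ≡ x zero ℙ.* 1ℙ)
             (∑-tail-0 (λ i → x (suc (suc i)) ℙ.+ x zero)) (equation zero))
    xⱼ≡X : ∀ j → x (suc (suc j)) ≡ X
    xⱼ≡X j = rowⱼ (x zero) xⱼ X
      (subst (λ x₁ → (x zero ℙ.+ xⱼ) ℙ.* 0ℙ ℙ.+ ((x₁ ℙ.+ xⱼ) ℙ.* 1ℙ ℙ.+ X) ≡ xⱼ ℙ.* 0ℙ) x₁≡0
        (subst (λ S → (x zero ℙ.+ xⱼ) ℙ.* 0ℙ ℙ.+ ((x (suc zero) ℙ.+ xⱼ) ℙ.* 1ℙ ℙ.+ S) ≡ xⱼ ℙ.* 0ℙ)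
               (∑-tail-1 xⱼ) (equation (suc (suc j)))))
      where xⱼ = x (suc (suc j))
    X≡0 : X ≡ 0ℙ
    X≡0 = trans (∑ℙ-cong {n′} xⱼ≡X) (trans (∑ℙ-const n′ X) (cong (ℙ._* X) n′-even))
    x₀≡X : x zero ≡ X
    x₀≡X = row₁ (x zero) X
      (subst (λ x₁ → (x zero ℙ.+ x₁) ℙ.* 1ℙ ℙ.+ ((x₁ ℙ.+ x₁) ℙ.* 1ℙ ℙ.+ X) ≡ x₁ ℙ.* 0ℙ) x₁≡0
        (subst (λ S → (x zero ℙ.+ x₁) ℙ.* 1ℙ ℙ.+ ((x₁ ℙ.+ x₁) ℙ.* 1ℙ ℙ.+ S) ≡ x₁ ℙ.* 0ℙ)
               (∑-tail-1 x₁) (equation (suc zero))))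
      where x₁ = x (suc zero)
    x≡0 : ∀ j → x j ≡ 0ℙ
    x≡0 zero          = trans x₀≡X X≡0
    x≡0 (suc zero)    = x₁≡0
    x≡0 (suc (suc j)) = trans (xⱼ≡X j) X≡0

halve-mod-8 : ∀ {ℓ r} → ℓ % 8 ≡ suc (r ℕ.+ r) → ∃ λ h → ℓ ≡ suc (h ℕ.+ h) × parity h ≡ parity r
halve-mod-8 {ℓ} {r} ℓ%8≡2r+1 = r ℕ.+ ℓ / 8 ℕ.* 4 , ℓ≡2h+1 , parity-h
  where
  ℓ≡2h+1 : ℓ ≡ suc ((r ℕ.+ ℓ / 8 ℕ.* 4) ℕ.+ (r ℕ.+ ℓ / 8 ℕ.* 4))
  ℓ≡2h+1 = trans (m≡m%n+[m/n]*n ℓ 8) (trans (cong (ℕ._+ ℓ / 8 ℕ.* 8) ℓ%8≡2r+1) (regroup r (ℓ / 8)))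
    where regroup : ∀ r q → suc (r ℕ.+ r) ℕ.+ q ℕ.* 8 ≡ suc ((r ℕ.+ q ℕ.* 4) ℕ.+ (r ℕ.+ q ℕ.* 4))
          regroup = ℕ-Solver.solve-∀
  parity-h : parity (r ℕ.+ ℓ / 8 ℕ.* 4) ≡ parity r
  parity-h = trans (ℙ.+-homo-+ r (ℓ / 8 ℕ.* 4))
               (trans (cong (parity r ℙ.+_) (trans (ℙ.*-homo-* (ℓ / 8) 4) (ℙ.*-zeroʳ (parity (ℓ / 8)))))
                      (ℙ.+-identityʳ (parity r)))

δ₀-pos : ∀ {n} → 1 ≤ n → δ₀ n ≡ 0ℙ
δ₀-pos (s≤s _) = refl

-- The NonZero instances of the hypotheses are irrelevant, so they are taken from primality.
module Lemma-5-3 {n′ : ℕ} (ℓ : Fin (2 ℕ.+ n′) → ℕ) (ℓ-prime : ∀ i → Prime (ℓ i)) (ℓ-injective : Injective _≡_ _≡_ ℓ)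
  (ℓ₀≡3 : ∀ i → toℕ i ≡ 0 → ℓ i % 8 ≡ 3) (ℓᵢ≡5 : ∀ i → 1 ≤ toℕ i → ℓ i % 8 ≡ 5)
  (L01 : ∀ i j → toℕ i ≡ 0 → toℕ j ≡ 1 → legendre (ℓ i) (ℓ j) {{prime⇒nonZero (ℓ-prime j)}} ≡ - (+ 1))
  (L0j : ∀ i j → toℕ i ≡ 0 → 2 ≤ toℕ j → legendre (ℓ i) (ℓ j) {{prime⇒nonZero (ℓ-prime j)}} ≡ + 1)
  (Lij : ∀ i j → 1 ≤ toℕ i → toℕ i < toℕ j → legendre (ℓ i) (ℓ j) {{prime⇒nonZero (ℓ-prime j)}} ≡ - (+ 1)) where

  halve : ∀ j → ∃ λ h → ℓ j ≡ suc (h ℕ.+ h) × parity h ≡ δ₀ (toℕ j)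
  halve j with toℕ j in j≡
  ... | zero  = halve-mod-8 {r = 1} (ℓ₀≡3 j j≡)
  ... | suc _ = halve-mod-8 {r = 2} (ℓᵢ≡5 j (subst (1 ≤_) (sym j≡) (s≤s z≤n)))

  h : Fin (2 ℕ.+ n′) → ℕ
  h j = proj₁ (halve j)

  ℓ≡2h+1 : ∀ j → ℓ j ≡ suc (h j ℕ.+ h j)
  ℓ≡2h+1 j = proj₁ (proj₂ (halve j))

  parity-h : ∀ j → parity (h j) ≡ δ₀ (toℕ j)
  parity-h j = proj₂ (proj₂ (halve j))

  μ : Fin (2 ℕ.+ n′) → Fin (2 ℕ.+ n′) → Parity
  μ j i = gaussParity (ℓ j) (h j) (ℓ i) {{prime⇒nonZero (ℓ-prime j)}}

  μ-below : ∀ i j → toℕ i < toℕ j → μ j i ≡ nonresidue (toℕ j) (toℕ i)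
  μ-below i j = below (toℕ i) (toℕ j) refl refl
    where
    module Eⱼ = Euler {h = h j} (ℓ-prime j) (ℓ≡2h+1 j)
    below : ∀ a b → toℕ i ≡ a → toℕ j ≡ b → a < b → μ j i ≡ nonresidue b a
    below zero    (suc zero)    i≡0 j≡1 _   = Eⱼ.euler-nonresidue {ℓ i} (L01 i j i≡0 j≡1)
    below zero    (suc (suc _)) i≡0 j≡b _   = Eⱼ.euler-residue {ℓ i} (L0j i j i≡0 (subst (2 ≤_) (sym j≡b) (s≤s (s≤s z≤n))))
    below (suc _) (suc _)       i≡a j≡b a<b =
      Eⱼ.euler-nonresidue {ℓ i} (Lij i j (subst (1 ≤_) (sym i≡a) (s≤s z≤n)) (subst₂ _<_ (sym i≡a) (sym j≡b) a<b))

  -- Reciprocity makes μ symmetric, since h i is even for i ≥ 1.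
  μ-above : ∀ i j → toℕ j < toℕ i → μ j i ≡ nonresidue (toℕ j) (toℕ i)
  μ-above i j j<i = begin
    μ j i                       ≡⟨ ℙ-+≡0⇒≡ (μ j i) (μ i j) μⱼᵢ+μᵢⱼ≡0 ⟩
    μ i j                       ≡⟨ μ-below j i j<i ⟩
    nonresidue (toℕ i) (toℕ j)  ≡⟨ nonresidue-sym (toℕ i) (toℕ j) ⟩
    nonresidue (toℕ j) (toℕ i)  ∎
    where
    open ≡-Reasoning
    ℓⱼ≢ℓᵢ : ℓ j ≢ ℓ i
    ℓⱼ≢ℓᵢ ℓⱼ≡ℓᵢ = ℕ.<⇒≢ j<i (cong toℕ (ℓ-injective ℓⱼ≡ℓᵢ))
    μⱼᵢ+μᵢⱼ≡0 : μ j i ℙ.+ μ i j ≡ 0ℙ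
    μⱼᵢ+μᵢⱼ≡0 = begin
      μ j i ℙ.+ μ i j
        ≡⟨ quadratic-reciprocity {h = h j} {h′ = h i} (ℓ-prime j) (ℓ-prime i) (ℓ≡2h+1 j) (ℓ≡2h+1 i) ℓⱼ≢ℓᵢ ⟩
      parity (h j) ℙ.* parity (h i)
        ≡⟨ cong (parity (h j) ℙ.*_) (trans (parity-h i) (δ₀-pos (ℕ.<-≤-trans (s≤s z≤n) j<i))) ⟩
      parity (h j) ℙ.* 0ℙ
        ≡⟨ ℙ.*-zeroʳ (parity (h j)) ⟩
      0ℙ
        ∎

  μ-pattern : ∀ i j → i ≢ j → μ j i ≡ nonresidue (toℕ j) (toℕ i)
  μ-pattern i j i≢j with ℕ.<-cmp (toℕ i) (toℕ j)
  ... | tri< i<j _ _ = μ-below i j i<j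
  ... | tri≈ _ i≡j _ = contradiction (Fin.toℕ-injective i≡j) i≢j
  ... | tri> _ _ j<i = μ-above i j j<i

  -- Modulo ℓⱼ: if ℓⱼ ∣ k then e g² ≡ 1, and if ℓⱼ ∣ k + 1 then d t² ≡ −1; Euler's
  -- criterion turns each congruence into row j of the system.
  module _ {k g t : ℕ} (x : Fin (2 ℕ.+ n′) → Parity)
           (k+1≡eg² : suc k ≡ ∏⟨ x ⟩ ℓ ℕ.* (g ℕ.* g)) (k≡dt² : k ≡ ∏⟨ ∁ x ⟩ ℓ ℕ.* (t ℕ.* t)) where

    private
      ℓⱼ∤ℓᵢ : ∀ (y : Fin (2 ℕ.+ n′) → Parity) j → y j ≡ 0ℙ → ∀ i → y i ≡ 1ℙ → ¬ ℓ j ∣ ℓ i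
      ℓⱼ∤ℓᵢ y j yⱼ≡0 i yᵢ≡1 = prime∤prime (ℓ-prime j) (ℓ-prime i)
        λ ℓⱼ≡ℓᵢ → contradiction (trans (sym yⱼ≡0) (trans (cong y (ℓ-injective ℓⱼ≡ℓᵢ)) yᵢ≡1)) λ ()

      e-condition : ∀ j → x j ≡ 0ℙ → ∑ℙ (λ i → x i ℙ.* μ j i) ≡ 0ℙ
      e-condition j xⱼ≡0 = sgn-injective-mod (Gauss.2<p {h = h j} (ℓ-prime j) (ℓ≡2h+1 j))
        (≡-mod-trans (subset-character {h = h j} (ℓ-prime j) (ℓ≡2h+1 j) ℓ x {g} (ℓⱼ∤ℓᵢ x j xⱼ≡0)
                                       eg²≡1 (1≢0-mod (ℓ-prime j)))
                     (≡⇒≡-mod (ℤ.^-zeroˡ (h j))))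
        where
        ℓⱼ∣k : ℓ j ∣ k
        ℓⱼ∣k = ℕ∣.∣-trans (select-∣-∏⟨⟩ (∁ x) ℓ (cong (ℙ._+ 1ℙ) xⱼ≡0))
                          (subst (∏⟨ ∁ x ⟩ ℓ ∣_) (sym k≡dt²) (ℕ∣.m∣m*n (t ℕ.* t)))
        eg²≡1 : + (∏⟨ x ⟩ ℓ ℕ.* (g ℕ.* g)) ≡ + 1 mod ℓ j
        eg²≡1 = ≡-mod-trans (≡⇒≡-mod (trans (cong +_ (sym k+1≡eg²)) (ℤ.pos-+ 1 k)))
                            (+-cong-mod (≡-mod-refl {x = + 1}) (ℕ∣⇒≡0-mod ℓⱼ∣k))

      d-condition : ∀ j → x j ≡ 1ℙ → ∑ℙ (λ i → ∁ x i ℙ.* μ j i) ≡ parity (h j)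
      d-condition j xⱼ≡1 = sgn-injective-mod (Gauss.2<p {h = h j} (ℓ-prime j) (ℓ≡2h+1 j))
        (≡-mod-trans (subset-character {h = h j} (ℓ-prime j) (ℓ≡2h+1 j) ℓ (∁ x) {t}
                                       (ℓⱼ∤ℓᵢ (∁ x) j (cong (ℙ._+ 1ℙ) xⱼ≡1)) dt²≡-1 (1≢0-mod (ℓ-prime j) ∘ -‿cong-mod))
                     (≡⇒≡-mod (-1^≡sgn-parity (h j))))
        where
        ℓⱼ∣k+1 : ℓ j ∣ suc k
        ℓⱼ∣k+1 = ℕ∣.∣-trans (select-∣-∏⟨⟩ x ℓ xⱼ≡1)
                            (subst (∏⟨ x ⟩ ℓ ∣_) (sym k+1≡eg²) (ℕ∣.m∣m*n (g ℕ.* g)))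
        k≡1+k-1 : ∀ k → + k ≡ + suc k + - + 1
        k≡1+k-1 k = trans (shift (+ k)) (cong (_+ - + 1) (sym (ℤ.pos-+ 1 k)))
          where shift : ∀ y → y ≡ + 1 + y + - + 1
                shift = solve-∀
        dt²≡-1 : + (∏⟨ ∁ x ⟩ ℓ ℕ.* (t ℕ.* t)) ≡ - + 1 mod ℓ j
        dt²≡-1 = ≡-mod-trans (≡⇒≡-mod (trans (cong +_ (sym k≡dt²)) (k≡1+k-1 k)))
                             (+-cong-mod (ℕ∣⇒≡0-mod ℓⱼ∣k+1) (≡-mod-refl {x = - + 1}))

    split-equations : ∀ j → ∑ℙ (λ i → (x i ℙ.+ x j) ℙ.* nonresidue (toℕ j) (toℕ i)) ≡ x j ℙ.* δ₀ (toℕ j)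
    split-equations j = trans (∑ℙ-cong {2 ℕ.+ n′} to-μ) (by-xⱼ (x j) refl)
      where
      to-μ : ∀ i → (x i ℙ.+ x j) ℙ.* nonresidue (toℕ j) (toℕ i) ≡ (x i ℙ.+ x j) ℙ.* μ j i
      to-μ i with i Fin.≟ j
      ... | yes refl = trans (cong (ℙ._* _) (ℙ.p+p≡0ℙ (x j))) (sym (cong (ℙ._* μ j j) (ℙ.p+p≡0ℙ (x j))))
      ... | no  i≢j  = cong ((x i ℙ.+ x j) ℙ.*_) (sym (μ-pattern i j i≢j))
      by-xⱼ : ∀ c → x j ≡ c → ∑ℙ (λ i → (x i ℙ.+ c) ℙ.* μ j i) ≡ c ℙ.* δ₀ (toℕ j)
      by-xⱼ 0ℙ xⱼ≡0 = trans (∑ℙ-cong {2 ℕ.+ n′} (λ i → cong (ℙ._* μ j i) (ℙ.+-identityʳ (x i)))) (e-condition j xⱼ≡0)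
      by-xⱼ 1ℙ xⱼ≡1 = trans (d-condition j xⱼ≡1) (parity-h j)

  smaller-unit : parity n′ ≡ 0ℙ → ∀ {k c} → k ℕ.* suc k ≡ prodFin (2 ℕ.+ n′) ℓ ℕ.* (c ℕ.* c) → 1 ≤ c →
                 ∃₂ λ g t → g ℕ.* g ≡ suc (prodFin (2 ℕ.+ n′) ℓ ℕ.* (t ℕ.* t)) × 1 ≤ g × 1 ≤ t × t < c ℕ.* 2
  smaller-unit n′-even {k} {c} k[k+1]≡mc² 1≤c = from-split (consecutive-split ℓ ℓ-prime ℓ-injective {k} {c} k[k+1]≡∏c²)
    where
    instance
      m-nonZero : NonZero (prodFin (2 ℕ.+ n′) ℓ)
      m-nonZero = subst NonZero (sym (prodFin≡∏ℕ _ ℓ)) (∏ℕ-nonZero ℓ (prime⇒nonZero ∘ ℓ-prime))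
    k[k+1]≡∏c² : k ℕ.* suc k ≡ ∏ℕ ℓ ℕ.* (c ℕ.* c)
    k[k+1]≡∏c² = subst (λ m → k ℕ.* suc k ≡ m ℕ.* (c ℕ.* c)) (prodFin≡∏ℕ _ ℓ) k[k+1]≡mc²
    from-split : (∃ λ x → ∃₂ λ g t → suc k ≡ ∏⟨ x ⟩ ℓ ℕ.* (g ℕ.* g) × k ≡ ∏⟨ ∁ x ⟩ ℓ ℕ.* (t ℕ.* t)) →
                 ∃₂ λ g t → g ℕ.* g ≡ suc (prodFin (2 ℕ.+ n′) ℓ ℕ.* (t ℕ.* t)) × 1 ≤ g × 1 ≤ t × t < c ℕ.* 2
    from-split (x , g , t , k+1≡eg² , k≡dt²) =
      g , t , smaller-solution {prodFin (2 ℕ.+ n′) ℓ} {k} {c} {g} {t} k[k+1]≡mc² 1≤c k+1≡g² k≡mt²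
      where
      x≡0 : ∀ i → x i ≡ 0ℙ
      x≡0 = only-trivial-split n′-even x (split-equations {k} {g} {t} x k+1≡eg² k≡dt²)
      k+1≡g² : suc k ≡ g ℕ.* g
      k+1≡g² = trans k+1≡eg² (trans (cong (ℕ._* (g ℕ.* g)) (∏⟨0⟩≡1 x ℓ x≡0)) (ℕ.*-identityˡ (g ℕ.* g)))
      k≡mt² : k ≡ prodFin (2 ℕ.+ n′) ℓ ℕ.* (t ℕ.* t)
      k≡mt² = trans k≡dt² (cong (ℕ._* (t ℕ.* t)) (trans (∏⟨∁0⟩≡∏ x ℓ x≡0) (sym (prodFin≡∏ℕ _ ℓ))))

  no-even-b : parity n′ ≡ 0ℙ → ∀ {a b} → IsFundamentalUnit (prodFin (2 ℕ.+ n′) ℓ) a b → ¬ 2 ∣ ∣ b ∣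
  no-even-b n′-even {a} {b} fu 2∣b =
    let k , c , k[k+1]≡mc² , 1≤c , minimal = fundamental-unit-even-b {prodFin (2 ℕ.+ n′) ℓ} {a} {b} fu 2∣b
        g , t , g²≡1+mt² , 1≤g , 1≤t , t<2c = smaller-unit n′-even {k} {c} k[k+1]≡mc² 1≤c
    in ℕ.<⇒≱ t<2c (minimal g t g²≡1+mt² 1≤g 1≤t)

lemma5p3 : (n : ℕ) → 2 ≤ n → (∃ λ k → n ≡ 2 * k) →
    (ℓ : Fin n → ℕ) →
    (∀ i → Prime (ℓ i)) →
    (nz : ∀ i → NonZero (ℓ i)) →
    Injective _≡_ _≡_ ℓ →
    (∀ i → toℕ i ≡ 0 → ℓ i % 8 ≡ 3) →
    (∀ i → 1 ≤ toℕ i → ℓ i % 8 ≡ 5) →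
    (∀ i j → toℕ i ≡ 0 → toℕ j ≡ 1 → legendre (ℓ i) (ℓ j) {{nz j}} ≡ - (+ 1)) →
    (∀ i j → toℕ i ≡ 0 → 2 ≤ toℕ j → legendre (ℓ i) (ℓ j) {{nz j}} ≡ + 1) →
    (∀ i j → 1 ≤ toℕ i → toℕ i < toℕ j → legendre (ℓ i) (ℓ j) {{nz j}} ≡ - (+ 1)) →
    (a b : ℤ) → IsFundamentalUnit (prodFin n ℓ) a b →
    ∣ b ∣ % 2 ≡ 1
lemma5p3 (suc zero) (s≤s ())
lemma5p3 (suc (suc n′)) _ (k , n≡2k) ℓ ℓ-prime _ ℓ-injective ℓ₀≡3 ℓᵢ≡5 L01 L0j Lij a b fu =
  ∤2⇒%2≡1 ∣ b ∣ (no-even-b n′-even fu)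
  where
  open Lemma-5-3 ℓ ℓ-prime ℓ-injective ℓ₀≡3 ℓᵢ≡5 L01 L0j Lij
  n′-even : parity n′ ≡ 0ℙ
  n′-even = trans (cong parity n≡2k) (ℙ.*-homo-* 2 k)
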